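{- Let $n\ge 6$ be an integer with $n\equiv 1$, $n\equiv 2$, or $n\equiv 3 \pmod 5$. Then $\iota_{\rm g}(P_n)=\iota_{\rm g}'(P_n)=\left\lfloor\frac{2n+2}{5}\right\rfloor$, where $P_n$ is the path on $n$ vertices.
   Context: All graphs are finite and simple; $N[S]$ denotes the closed neighborhood of a vertex set $S$. In the isolation game on a graph $G$, Dominator and Staller alternately choose vertices; if $S$ is the set of already chosen vertices, a vertex $x$ may be chosen only if it equals or is adjacent to some vertex $y$ lying in a component of $G-N[S]$ that has at least one edge. The game ends when no such vertex exists. Dominator wants to minimize the number of chosen vertices, Staller wants to maximize it. $\iota_{\rm g}(G)$ (resp. $\iota_{\rm g}'(G)$) is the number of chosen vertices under optimal play when Dominator (resp. Staller) moves first. -}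

module Defs where

open import Data.Nat using (ℕ; zero; suc; _+_; _⊔_; _⊓_; _≡ᵇ_)
open import Data.Bool using (Bool; true; false; _∧_; _∨_; not; if_then_else_)
open import Data.Fin using (Fin; toℕ; _≟_)
open import Data.List using (List; []; _∷_; filter; foldr; map)
open import Relation.Nullary.Decidable using (⌊_⌋)
open import Relation.Binary.PropositionalEquality using (_≡_)
open import Data.Bool.ListAction using () renaming (any to anyL)

open import Data.List using (allFin) public

record Graph : Set where
  field
    n      : ℕ
    adj    : Fin n → Fin n → Bool
    sym    : ∀ u v → adj u v ≡ adj v u
    irrefl : ∀ v → adj v v ≡ false
open Graph public

pathAdj : ∀ {n} → Fin n → Fin n → Bool
pathAdj i j = (suc (toℕ i) ≡ᵇ toℕ j) ∨ (suc (toℕ j) ≡ᵇ toℕ i)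

private
  ∨-comm : ∀ a b → (a ∨ b) ≡ (b ∨ a)
  ∨-comm false false = _≡_.refl
  ∨-comm false true  = _≡_.refl
  ∨-comm true  false = _≡_.refl
  ∨-comm true  true  = _≡_.refl

  suc≢ᵇ : ∀ m → (suc m ≡ᵇ m) ≡ false
  suc≢ᵇ zero    = _≡_.refl
  suc≢ᵇ (suc m) = suc≢ᵇ m

  irr : ∀ {n} (v : Fin n) → pathAdj v v ≡ false
  irr v with suc≢ᵇ (toℕ v)
  ... | e rewrite e = _≡_.refl

P : ℕ → Graph
P k = record
  { n = k
  ; adj = pathAdj
  ; sym = λ u v → ∨-comm (suc (toℕ u) ≡ᵇ toℕ v) (suc (toℕ v) ≡ᵇ toℕ u)
  ; irrefl = irr
  }

module Isolation (G : Graph) where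
  V : Set
  V = Fin (n G)

  VSet : Set
  VSet = V → Bool

  eqᵇ : V → V → Bool
  eqᵇ u v = ⌊ u ≟ v ⌋

  ∅ : VSet
  ∅ _ = false

  insert : V → VSet → VSet
  insert x S v = eqᵇ v x ∨ S v

  anyV : (V → Bool) → Bool
  anyV p = anyL p (allFin (n G))

  inN : VSet → V → Bool
  inN S v = anyV (λ u → S u ∧ (eqᵇ u v ∨ adj G u v))

  free : VSet → V → Bool
  free S v = not (inN S v)

  -- reach S k y z : z is reachable from y by a walk of length ≤ k in G - N[S]
  -- (y is assumed to be a vertex of G - N[S])
  reach : VSet → ℕ → V → V → Bool
  reach S zero    y z = eqᵇ y z
  reach S (suc k) y z =
    reach S k y z ∨ anyV (λ w → reach S k y w ∧ free S z ∧ adj G w z)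

  -- y lies in a component of G - N[S] that has at least one edge
  inNontrivialComp : VSet → V → Bool
  inNontrivialComp S y =
    free S y ∧ anyV (λ z → reach S (n G) y z ∧ anyV (λ w → free S w ∧ adj G z w))

  legal : VSet → V → Bool
  legal S x = anyV (λ y → inNontrivialComp S y ∧ (eqᵇ x y ∨ adj G x y))

  legalMoves : VSet → List V
  legalMoves S = filter (λ x → Data.Bool._≟_ (legal S x) true) (allFin (n G))

  -- optimal remaining number of moves: fuel k, whose turn (true = Dominator), chosen set S.
  -- Every legal move is a not-yet-chosen vertex, so the game lasts at most n G moves,
  -- and fuel n G computes the exact game value.
  value : ℕ → Bool → VSet → ℕ
  value zero    d S = 0
  value (suc k) d S with legalMoves S
  ... | []     = 0
  ... | x ∷ xs = suc (foldr (if d then _⊓_ else _⊔_) (value k (not d) (insert x S))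
                              (map (λ y → value k (not d) (insert y S)) xs))

-- ι_g(G): Dominator starts; ι_g'(G): Staller starts
ιg : Graph → ℕ
ιg G = Isolation.value G (n G) true (Isolation.∅ G)

ιg' : Graph → ℕ
ιg' G = Isolation.value G (n G) false (Isolation.∅ G)

-- Choosing x on the path 0 - 1 - ... - (N - 1) removes from play exactly the edges {e, e + 1} with
-- x - 2 ≤ e ≤ x + 1, and x is legal iff it removes a live edge: the game destroys the N - 1 edges
-- with windows of four consecutive edges.
-- Lower bounds: once a vertex has been chosen, Staller can always destroy exactly one edge (next to
-- an already destroyed one) while Dominator destroys at most four. Staller's opening at vertex 3
-- isolates the first edge, which costs one extra move.
-- Upper bounds: shift the edges into blocks of five cells and let each block contribute
-- min(2, its live cells). Whatever Staller plays, Dominator can answer so that the two moves lower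
-- this potential by 2, so the potential bounds the game from any position with Staller to move.
-- Openings and shifts are chosen so that the live runs of edges start or end at block boundaries;
-- for n ≡ 1, 2, 3 (mod 5) the two bounds then coincide.

module Submission where

open import Defs hiding (sym)
open import Data.Bool using (Bool; true; false; not; _∧_; _∨_; if_then_else_; T)
import Data.Bool.Properties as Bool
open import Data.Empty using (⊥)
open import Data.Fin using (toℕ; fromℕ<)
open import Data.Fin.Properties using (toℕ-fromℕ<; toℕ<n; toℕ-injective; all?; any?)
open import Data.List using (List; []; _∷_; foldr; map)
open import Data.List.Properties using (foldr-preservesᵇ; foldr-preservesᵒ)
open import Data.List.Membership.Propositional using (_∈_; lose)
open import Data.List.Membership.Propositional.Properties using (∈-filter⁺; ∈-filter⁻; ∈-allFin)
open import Data.List.Relation.Unary.All as All using (All; _∷_)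
import Data.List.Relation.Unary.All.Properties as AllProp
open import Data.List.Relation.Unary.Any as Any using (Any; here; there; satisfied)
open import Data.List.Relation.Unary.Any.Properties as AnyProp using (any⁺; any⁻)
open import Data.Nat
open import Data.Nat.Properties
open import Algebra.Properties.CommutativeSemigroup +-commutativeSemigroup using (interchange; x∙yz≈y∙xz)
open import Data.Nat.DivMod using (m≡m%n+[m/n]*n; m%n<n; +-distrib-/-∣ʳ; m*n/n≡m)
open import Data.Nat.Divisibility using (divides-refl)
open import Data.Nat.Tactic.RingSolver using (solve-∀)
open import Data.Product using (∃; ∃₂; ∃-syntax; _×_; _,_; proj₁; proj₂)
open import Data.Sum using (_⊎_; inj₁; inj₂; [_,_])
open import Data.Unit using (tt)
open import Function using (_∘_; id; Equivalence)
open import Relation.Nullary using (¬_; Dec; yes; no; _×-dec_; _→-dec_; ¬?; contradiction)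
open import Relation.Nullary.Decidable using (T?; toWitness; fromWitness; decidable-stable)
open import Relation.Unary using (Decidable)
open import Relation.Binary.Definitions using (Tri; tri<; tri≈; tri>)
open import Relation.Binary.PropositionalEquality
  using (_≡_; _≢_; refl; sym; trans; cong; cong₂; subst; subst₂; module ≡-Reasoning)

-- Counting

indicator : ∀ {A : Set} → Dec A → ℕ
indicator (yes _) = 1
indicator (no _)  = 0

count : {P : ℕ → Set} → Decidable P → ℕ → ℕ
count P? zero    = 0
count P? (suc m) = indicator (P? m) + count P? m

indicator-mono : ∀ {A B : Set} (A? : Dec A) (B? : Dec B) → (A → B) → indicator A? ≤ indicator B?
indicator-mono (yes _) (yes _) _   = ≤-refl
indicator-mono (yes a) (no ¬b) A⇒B = contradiction (A⇒B a) ¬b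
indicator-mono (no _)  _       _   = z≤n

indicator-⊎ : ∀ {A B C : Set} (A? : Dec A) (B? : Dec B) (C? : Dec C) → (A → B ⊎ C) →
              indicator A? ≤ indicator B? + indicator C?
indicator-⊎ (no _)  _       _       _     = z≤n
indicator-⊎ (yes _) (yes _) _       _     = s≤s z≤n
indicator-⊎ (yes _) (no _)  (yes _) _     = ≤-refl
indicator-⊎ (yes a) (no ¬b) (no ¬c) A⇒B⊎C with A⇒B⊎C a
... | inj₁ b = contradiction b ¬b
... | inj₂ c = contradiction c ¬c

count-mono : ∀ {P Q : ℕ → Set} (P? : Decidable P) (Q? : Decidable Q) m →
             (∀ {e} → e < m → P e → Q e) → count P? m ≤ count Q? m
count-mono P? Q? zero    P⊆Q = z≤n
count-mono P? Q? (suc m) P⊆Q =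
  +-mono-≤ (indicator-mono (P? m) (Q? m) (P⊆Q ≤-refl)) (count-mono P? Q? m (P⊆Q ∘ m<n⇒m<1+n))

count-cong : ∀ {P Q : ℕ → Set} (P? : Decidable P) (Q? : Decidable Q) →
             (∀ {e} → P e → Q e) → (∀ {e} → Q e → P e) → ∀ m → count P? m ≡ count Q? m
count-cong P? Q? P⊆Q Q⊆P m = ≤-antisym (count-mono P? Q? m (λ _ → P⊆Q)) (count-mono Q? P? m (λ _ → Q⊆P))

count-∪ : ∀ {P Q R : ℕ → Set} (P? : Decidable P) (Q? : Decidable Q) (R? : Decidable R) →
          (∀ {e} → P e → Q e ⊎ R e) → ∀ m → count P? m ≤ count Q? m + count R? m
count-∪ P? Q? R? P⊆Q∪R zero    = z≤n
count-∪ P? Q? R? P⊆Q∪R (suc m) = begin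
  indicator (P? m) + count P? m
    ≤⟨ +-mono-≤ (indicator-⊎ (P? m) (Q? m) (R? m) P⊆Q∪R) (count-∪ P? Q? R? P⊆Q∪R m) ⟩
  (indicator (Q? m) + indicator (R? m)) + (count Q? m + count R? m)
    ≡⟨ interchange (indicator (Q? m)) _ _ _ ⟩
  count Q? (suc m) + count R? (suc m) ∎
  where open ≤-Reasoning

count-strict : ∀ {P Q : ℕ → Set} (P? : Decidable P) (Q? : Decidable Q) →
               (∀ {e} → Q e → P e) → ∀ {c m} → P c → ¬ Q c → c < m →
               suc (count Q? m) ≤ count P? m
count-strict P? Q? Q⊆P {c} {suc m} pc ¬qc (s≤s c≤m) with m≤n⇒m<n∨m≡n c≤m
... | inj₁ c<m = ≤-trans (≤-reflexive (sym (+-suc _ _)))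
                   (+-mono-≤ (indicator-mono (Q? m) (P? m) Q⊆P) (count-strict P? Q? Q⊆P pc ¬qc c<m))
... | inj₂ refl with P? c | Q? c
...   | yes _ | no _  = s≤s (count-mono Q? P? c (λ _ → Q⊆P))
...   | no ¬p | _     = contradiction pc ¬p
...   | _     | yes q = contradiction q ¬qc

count>0⇒∃ : ∀ {P : ℕ → Set} (P? : Decidable P) m → 0 < count P? m → ∃ λ e → e < m × P e
count>0⇒∃ P? (suc m) pos with P? m
... | yes p = m , ≤-refl , p
... | no _  with count>0⇒∃ P? m pos
...   | e , e<m , p = e , m<n⇒m<1+n e<m , p

InRange : ℕ → ℕ → ℕ → Set
InRange lo hi e = lo ≤ e × e < hi

inRange? : ∀ lo hi → Decidable (InRange lo hi)
inRange? lo hi e = lo ≤? e ×-dec e <? hi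

count-range : ∀ lo hi m → count (inRange? lo hi) m ≡ m ⊓ hi ∸ lo
count-range lo hi zero = sym (0∸n≡0 lo)
count-range lo hi (suc m) with inRange? lo hi m | count-range lo hi m
... | yes (lo≤m , m<hi) | ih = begin
  suc (count (inRange? lo hi) m) ≡⟨ cong suc ih ⟩
  suc (m ⊓ hi ∸ lo)              ≡⟨ cong (λ k → suc (k ∸ lo)) (m≤n⇒m⊓n≡m (<⇒≤ m<hi)) ⟩
  suc (m ∸ lo)                   ≡⟨ sym (+-∸-assoc 1 lo≤m) ⟩
  suc m ∸ lo                     ≡⟨ cong (_∸ lo) (sym (m≤n⇒m⊓n≡m m<hi)) ⟩
  suc m ⊓ hi ∸ lo                ∎
  where open ≡-Reasoning
... | no ¬r | ih with lo ≤? m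
...   | no m≱lo  = trans ih (trans (m≤n⇒m∸n≡0 (≤-trans (m⊓n≤m m hi) (<⇒≤ m<lo)))
                                   (sym (m≤n⇒m∸n≡0 (≤-trans (m⊓n≤m (suc m) hi) m<lo))))
  where m<lo = ≰⇒> m≱lo
...   | yes lo≤m = trans ih (cong (_∸ lo) (trans (m≥n⇒m⊓n≡n hi≤m) (sym (m≥n⇒m⊓n≡n (m≤n⇒m≤1+n hi≤m)))))
  where hi≤m = ≮⇒≥ (λ m<hi → ¬r (lo≤m , m<hi))

count-interval : ∀ {P : ℕ → Set} (P? : Decidable P) {lo hi} m →
                 (∀ {e} → e < m → P e → InRange lo hi e) → count P? m ≤ hi ∸ lo
count-interval P? {lo} {hi} m P⊆range = begin
  count P? m                ≤⟨ count-mono P? (inRange? lo hi) m P⊆range ⟩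
  count (inRange? lo hi) m  ≡⟨ count-range lo hi m ⟩
  m ⊓ hi ∸ lo               ≤⟨ ∸-monoˡ-≤ lo (m⊓n≤n m hi) ⟩
  hi ∸ lo                   ∎
  where open ≤-Reasoning

count-exact : ∀ {P : ℕ → Set} (P? : Decidable P) {lo hi m} →
              (∀ {e} → P e → InRange lo hi e) → (∀ {e} → InRange lo hi e → P e) → hi ≤ m →
              count P? m ≡ hi ∸ lo
count-exact P? {lo} {hi} {m} P⊆range range⊆P hi≤m = begin
  count P? m                ≡⟨ count-cong P? (inRange? lo hi) P⊆range range⊆P m ⟩
  count (inRange? lo hi) m  ≡⟨ count-range lo hi m ⟩
  m ⊓ hi ∸ lo               ≡⟨ cong (_∸ lo) (m≥n⇒m⊓n≡n hi≤m) ⟩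
  hi ∸ lo                   ∎
  where open ≡-Reasoning

count-zero : ∀ {P : ℕ → Set} (P? : Decidable P) m → (∀ {e} → e < m → ¬ P e) → count P? m ≡ 0
count-zero P? m none = n≤0⇒n≡0 (count-interval P? {0} {0} m (λ e<m p → contradiction p (none e<m)))

count≤1 : ∀ {P : ℕ → Set} (P? : Decidable P) {i} m → (∀ {e} → e < m → P e → e ≡ i) → count P? m ≤ 1
count≤1 {P} P? {i} m only-i = ≤-trans (count-interval P? m in-range) (≤-reflexive (m+n∸n≡m 1 i))
  where
  in-range : ∀ {e} → e < m → P e → InRange i (suc i) e
  in-range e<m p with only-i e<m p
  ... | refl = ≤-refl , ≤-refl

count≥1 : ∀ {P : ℕ → Set} (P? : Decidable P) {c m} → P c → c < m → 1 ≤ count P? m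
count≥1 P? pc c<m = ≤-trans (s≤s z≤n) (count-strict {Q = λ _ → ⊥} P? (λ _ → no λ ()) (λ ()) pc (λ ()) c<m)

module _ {P : ℕ → Set} (P? : Decidable P) (i : ℕ) where

  private
    P∖i? : Decidable (λ e → P e × e ≢ i)
    P∖i? e = P? e ×-dec ¬? (e ≟ i)

  count≥2 : ∀ {j m} → P i → P j → j ≢ i → i < m → j < m → 2 ≤ count P? m
  count≥2 pi pj j≢i i<m j<m =
    ≤-trans (s≤s (count≥1 P∖i? (pj , j≢i) j<m)) (count-strict P? P∖i? proj₁ pi (λ q → proj₂ q refl) i<m)

  count≥2⇒∃≢ : ∀ m → 2 ≤ count P? m → ∃ λ e → P e × e ≢ i
  count≥2⇒∃≢ m two
    with count>0⇒∃ P∖i? m (s≤s⁻¹ (≤-trans two (≤-trans (count-∪ P? P∖i? (_≟ i) split m) one-more)))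
    where
    split : ∀ {e} → P e → (P e × e ≢ i) ⊎ e ≡ i
    split {e} pe with e ≟ i
    ... | yes e≡i = inj₂ e≡i
    ... | no e≢i  = inj₁ (pe , e≢i)
    one-more : count P∖i? m + count (_≟ i) m ≤ suc (count P∖i? m)
    one-more = ≤-trans (+-monoʳ-≤ _ (count≤1 (_≟ i) m (λ _ e≡i → e≡i))) (≤-reflexive (+-comm _ 1))
  ... | e , _ , q = e , q

count-remove-one : ∀ {P Q : ℕ → Set} (P? : Decidable P) (Q? : Decidable Q) {c m} →
                   (∀ {e} → Q e → P e) → (∀ {e} → P e → Q e ⊎ e ≡ c) → P c → ¬ Q c → c < m →
                   count P? m ≡ suc (count Q? m)
count-remove-one P? Q? {c} {m} Q⊆P P⊆Q+c pc ¬qc c<m = ≤-antisym at-most (count-strict P? Q? Q⊆P pc ¬qc c<m)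
  where
  at-most : count P? m ≤ suc (count Q? m)
  at-most = ≤-trans (count-∪ P? Q? (_≟ c) P⊆Q+c m)
                    (≤-trans (+-monoʳ-≤ _ (count≤1 (_≟ c) m (λ _ e≡c → e≡c))) (≤-reflexive (+-comm _ 1)))

crossing : ∀ {P : ℕ → Set} → Decidable P → ∀ {a b} → a ≤ b → ¬ P a → P b →
           ∃ λ c → a ≤ c × c < b × ¬ P c × P (suc c)
crossing P? {b = zero}  z≤n ¬p0 p0 = contradiction p0 ¬p0
crossing P? {a} {suc b} a≤1+b ¬pa pb₊ with m≤n⇒m<n∨m≡n a≤1+b
... | inj₂ refl = contradiction pb₊ ¬pa
... | inj₁ a≤b with P? b
...   | no ¬pb = b , s≤s⁻¹ a≤b , ≤-refl , ¬pb , pb₊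
...   | yes pb with crossing P? (s≤s⁻¹ a≤b) ¬pa pb
...     | c , a≤c , c<b , ¬pc , pc₊ = c , a≤c , m<n⇒m<1+n c<b , ¬pc , pc₊

-- movesD m (movesS m): moves Staller's strategy still forces when m edges are live and Dominator
-- (Staller) is to move. movesS L is also the potential of a run of L cells starting at a block boundary.
movesD : ℕ → ℕ
movesD 0 = 0
movesD 1 = 1
movesD 2 = 1
movesD 3 = 1
movesD 4 = 1
movesD (suc (suc (suc (suc (suc m))))) = 2 + movesD m

movesS : ℕ → ℕ
movesS 0 = 0
movesS 1 = 1
movesS 2 = 2
movesS 3 = 2
movesS 4 = 2
movesS (suc (suc (suc (suc (suc m))))) = 2 + movesS m

movesS-suc : ∀ m → movesS (suc m) ≡ suc (movesD m)
movesS-suc 0 = refl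
movesS-suc 1 = refl
movesS-suc 2 = refl
movesS-suc 3 = refl
movesS-suc 4 = refl
movesS-suc (suc (suc (suc (suc (suc m))))) = cong (2 +_) (movesS-suc m)

movesD≤1+movesS[m∸4] : ∀ m → movesD m ≤ suc (movesS (m ∸ 4))
movesD≤1+movesS[m∸4] 0 = z≤n
movesD≤1+movesS[m∸4] 1 = ≤-refl
movesD≤1+movesS[m∸4] 2 = ≤-refl
movesD≤1+movesS[m∸4] 3 = ≤-refl
movesD≤1+movesS[m∸4] 4 = ≤-refl
movesD≤1+movesS[m∸4] (suc (suc (suc (suc (suc m))))) = ≤-reflexive (cong suc (sym (movesS-suc m)))

movesS-step : ∀ m → movesS m ≤ movesS (suc m)
movesS-step 0 = z≤n
movesS-step 1 = s≤s z≤n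
movesS-step 2 = ≤-refl
movesS-step 3 = ≤-refl
movesS-step 4 = ≤-refl
movesS-step (suc (suc (suc (suc (suc m))))) = +-monoʳ-≤ 2 (movesS-step m)

movesS-mono : ∀ {m n} → m ≤ n → movesS m ≤ movesS n
movesS-mono {m} m≤n with m≤n⇒∃[o]m+o≡n m≤n
... | o , refl = go o
  where
  go : ∀ o → movesS m ≤ movesS (m + o)
  go zero    = ≤-reflexive (cong movesS (sym (+-identityʳ m)))
  go (suc o) = ≤-trans (go o) (≤-trans (movesS-step (m + o)) (≤-reflexive (cong movesS (sym (+-suc m o)))))

movesD≤movesS : ∀ m → movesD m ≤ movesS m
movesD≤movesS 0 = z≤n
movesD≤movesS 1 = ≤-refl
movesD≤movesS 2 = s≤s z≤n
movesD≤movesS 3 = s≤s z≤n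
movesD≤movesS 4 = s≤s z≤n
movesD≤movesS (suc (suc (suc (suc (suc m))))) = +-monoʳ-≤ 2 (movesD≤movesS m)

+5*suc : ∀ r q → r + 5 * suc q ≡ 5 + (r + 5 * q)
+5*suc r q = trans (cong (r +_) (*-suc 5 q)) (x∙yz≈y∙xz r 5 (5 * q))

movesD-+5* : ∀ r q → movesD (r + 5 * q) ≡ movesD r + 2 * q
movesD-+5* r zero    = trans (cong movesD (+-identityʳ r)) (sym (+-identityʳ _))
movesD-+5* r (suc q) = trans (cong movesD (+5*suc r q)) (trans (cong (2 +_) (movesD-+5* r q))
                               (trans (x∙yz≈y∙xz 2 (movesD r) (2 * q)) (cong (movesD r +_) (sym (*-suc 2 q)))))

movesS-+5* : ∀ r q → movesS (r + 5 * q) ≡ movesS r + 2 * q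
movesS-+5* r zero    = trans (cong movesS (+-identityʳ r)) (sym (+-identityʳ _))
movesS-+5* r (suc q) = trans (cong movesS (+5*suc r q)) (trans (cong (2 +_) (movesS-+5* r q))
                               (trans (x∙yz≈y∙xz 2 (movesS r) (2 * q)) (cong (movesS r +_) (sym (*-suc 2 q)))))

-- The game value

module GameValue (G : Graph) where
  open Isolation G

  private
    after : ℕ → Bool → VSet → V → ℕ
    after k d S x = value k (not d) (insert x S)

    round : ℕ → Bool → VSet → List V → ℕ
    round k d S []       = 0
    round k d S (x ∷ xs) = suc (foldr (if d then _⊓_ else _⊔_) (after k d S x) (map (after k d S) xs))

    value-suc : ∀ k d S → value (suc k) d S ≡ round k d S (legalMoves S)
    value-suc k d S with legalMoves S
    ... | []     = refl
    ... | x ∷ xs = refl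

    legal⇒∈ : ∀ {S x} → T (legal S x) → x ∈ legalMoves S
    legal⇒∈ {S} {x} lx = ∈-filter⁺ _ (∈-allFin x) (Equivalence.to Bool.T-≡ lx)

    ∈⇒legal : ∀ {S x} → x ∈ legalMoves S → T (legal S x)
    ∈⇒legal {S} x∈ = Equivalence.from Bool.T-≡ (proj₂ (∈-filter⁻ _ {xs = allFin (n G)} x∈))

    legal-all : ∀ {P : V → Set} {S} → (∀ x → T (legal S x) → P x) → All P (legalMoves S)
    legal-all h = All.tabulate (λ x∈ → h _ (∈⇒legal x∈))

  dominator-≤ : ∀ {k S x} → T (legal S x) → value (suc k) true S ≤ suc (value k false (insert x S))
  dominator-≤ {k} {S} {x} lx = ≤-trans (≤-reflexive (value-suc k true S)) (go (legal⇒∈ lx))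
    where
    go : ∀ {xs} → x ∈ xs → round k true S xs ≤ suc (after k true S x)
    go {y ∷ ys} x∈ = s≤s (foldr-preservesᵒ {P = _≤ after k true S x}
      (λ a b → [ m≤n⇒m⊓o≤n b , m≤n⇒o⊓m≤n a ]) _ _ (chosen x∈))
      where
      chosen : x ∈ y ∷ ys → after k true S y ≤ after k true S x ⊎ Any (_≤ after k true S x) (map (after k true S) ys)
      chosen (here refl) = inj₁ ≤-refl
      chosen (there x∈ys) = inj₂ (AnyProp.map⁺ (Any.map (λ { refl → ≤-refl }) x∈ys))

  staller-≥ : ∀ {k S x} → T (legal S x) → suc (value k true (insert x S)) ≤ value (suc k) false S
  staller-≥ {k} {S} {x} lx = ≤-trans (go (legal⇒∈ lx)) (≤-reflexive (sym (value-suc k false S)))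
    where
    go : ∀ {xs} → x ∈ xs → suc (after k false S x) ≤ round k false S xs
    go {y ∷ ys} x∈ = s≤s (foldr-preservesᵒ {P = after k false S x ≤_}
      (λ a b → [ m≤n⇒m≤n⊔o b , m≤n⇒m≤o⊔n a ]) _ _ (chosen x∈))
      where
      chosen : x ∈ y ∷ ys → after k false S x ≤ after k false S y ⊎ Any (after k false S x ≤_) (map (after k false S) ys)
      chosen (here refl) = inj₁ ≤-refl
      chosen (there x∈ys) = inj₂ (AnyProp.map⁺ (Any.map (λ { refl → ≤-refl }) x∈ys))

  dominator-≥ : ∀ {k S x} B → T (legal S x) → (∀ y → T (legal S y) → B ≤ value k false (insert y S)) →
                suc B ≤ value (suc k) true S
  dominator-≥ {k} {S} B lx bound = ≤-trans (go (legal⇒∈ lx) (legal-all bound)) (≤-reflexive (sym (value-suc k true S)))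
    where
    go : ∀ {x xs} → x ∈ xs → All (λ y → B ≤ after k true S y) xs → suc B ≤ round k true S xs
    go {xs = y ∷ ys} _ (b ∷ bs) = s≤s (foldr-preservesᵇ {P = B ≤_} ⊓-glb b (AllProp.map⁺ bs))

  staller-≤ : ∀ {k S} B → (∀ y → T (legal S y) → suc (value k true (insert y S)) ≤ B) → value (suc k) false S ≤ B
  staller-≤ {k} {S} B bound = ≤-trans (≤-reflexive (value-suc k false S)) (go _ (legal-all bound))
    where
    go : ∀ xs → All (λ y → suc (after k false S y) ≤ B) xs → round k false S xs ≤ B
    go []       _          = z≤n
    go (y ∷ ys) (s≤s b ∷ bs) = s≤s (foldr-preservesᵇ {P = _≤ _} ⊔-lub b (AllProp.map⁺ (All.map s≤s⁻¹ bs)))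

  value-over : ∀ {k d S} → (∀ x → ¬ T (legal S x)) → value k d S ≡ 0
  value-over {zero}      _       = refl
  value-over {suc k} {d} {S} no-move = trans (value-suc k d S) (go (legalMoves S) (legal-all no-move))
    where
    go : ∀ xs → All (λ x → ⊥) xs → round k d S xs ≡ 0
    go []       _        = refl
    go (_ ∷ _) (() ∷ _)

-- Isolation on paths

Near : ℕ → ℕ → Set
Near a b = a ≡ b ⊎ suc a ≡ b ⊎ suc b ≡ a

-- N[u] meets the edge {e, e + 1}.
Meets : ℕ → ℕ → Set
Meets u e = u ≤ 2 + e × e ≤ 1 + u

meets? : ∀ u e → Dec (Meets u e)
meets? u e = u ≤? 2 + e ×-dec e ≤? 1 + u

near-suc : ∀ {a b} → Near a b → Near (suc a) (suc b)
near-suc (inj₁ refl)        = inj₁ refl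
near-suc (inj₂ (inj₁ refl)) = inj₂ (inj₁ refl)
near-suc (inj₂ (inj₂ refl)) = inj₂ (inj₂ refl)

Meets⇒Near : ∀ u e → Meets u e → Near u e ⊎ Near u (suc e)
Meets⇒Near zero             zero          _                 = inj₁ (inj₁ refl)
Meets⇒Near zero             (suc zero)    _                 = inj₁ (inj₂ (inj₁ refl))
Meets⇒Near (suc zero)       zero          _                 = inj₂ (inj₁ refl)
Meets⇒Near (suc (suc zero)) zero          _                 = inj₂ (inj₂ (inj₂ refl))
Meets⇒Near (suc u)          (suc e)       (u≤ , e≤)         with Meets⇒Near u e (s≤s⁻¹ u≤ , s≤s⁻¹ e≤)
... | inj₁ near = inj₁ (near-suc near)
... | inj₂ near = inj₂ (near-suc near)
Meets⇒Near zero             (suc (suc e)) (_ , s≤s ())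
Meets⇒Near (suc (suc (suc u))) zero       (s≤s (s≤s ()) , _)

Near⇒Meets : ∀ {u e} → Near u e ⊎ Near u (suc e) → Meets u e
Near⇒Meets (inj₁ (inj₁ refl))        = ≤-trans (n≤1+n _) (n≤1+n _) , n≤1+n _
Near⇒Meets (inj₁ (inj₂ (inj₁ refl))) = ≤-trans (n≤1+n _) (≤-trans (n≤1+n _) (n≤1+n _)) , ≤-refl
Near⇒Meets (inj₁ (inj₂ (inj₂ refl))) = n≤1+n _ , ≤-trans (n≤1+n _) (n≤1+n _)
Near⇒Meets (inj₂ (inj₁ refl))        = n≤1+n _ , ≤-trans (n≤1+n _) (n≤1+n _)
Near⇒Meets (inj₂ (inj₂ (inj₁ refl))) = ≤-trans (n≤1+n _) (n≤1+n _) , n≤1+n _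
Near⇒Meets (inj₂ (inj₂ (inj₂ refl))) = ≤-refl , ≤-trans (n≤1+n _) (≤-trans (n≤1+n _) (n≤1+n _))

meets-left-end : ∀ {s c} → Meets s c → ¬ Meets s (suc c) → c ≡ suc s
meets-left-end (s≤ , c≤) ¬m = ≤-antisym c≤ (≰⇒> λ c≤s → ¬m (≤-trans s≤ (n≤1+n _) , s≤s c≤s))

meets-right-end : ∀ {s c} → Meets s (suc c) → ¬ Meets s c → s ≡ 3 + c
meets-right-end (s≤ , c≤) ¬m = ≤-antisym s≤ (≰⇒> λ s≤2+c → ¬m (s≤2+c , ≤-trans (s≤s⁻¹ c≤) (n≤1+n _)))

meets-only-suc : ∀ {s e} → Meets (suc s) e → ¬ Meets s e → e ≡ 2 + s
meets-only-suc (s≤ , e≤) ¬m = ≤-antisym e≤ (≰⇒> λ e≤1+s → ¬m (≤-trans (n≤1+n _) s≤ , e≤1+s))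

meets-only-pred : ∀ {s e} → Meets s e → ¬ Meets (suc s) e → s ≡ 2 + e
meets-only-pred (s≤ , e≤) ¬m = ≤-antisym s≤ (s≤s⁻¹ (≰⇒> λ s<3+e → ¬m (s<3+e , ≤-trans e≤ (n≤1+n _))))

¬Meets⇒apart : ∀ {u e} → ¬ Meets u e → 3 + e ≤ u ⊎ 2 + u ≤ e
¬Meets⇒apart {u} {e} ¬meets with 3 + e ≤? u | 2 + u ≤? e
... | yes left | _        = inj₁ left
... | no _     | yes right = inj₂ right
... | no ¬left | no ¬right = contradiction (s≤s⁻¹ (≰⇒> ¬left) , s≤s⁻¹ (≰⇒> ¬right)) ¬meets

module PathGame (N : ℕ) where
  open Isolation (P N) public

  -- The edge {e, e + 1} lies in G - N[S].
  Alive : VSet → ℕ → Set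
  Alive S e = 2 + e ≤ N × (∀ u → T (S u) → ¬ Meets (toℕ u) e)

  alive? : ∀ S e → Dec (Alive S e)
  alive? S e = 2 + e ≤? N ×-dec all? (λ u → T? (S u) →-dec ¬? (meets? (toℕ u) e))

  Legal : VSet → V → Set
  Legal S x = ∃[ e ] Alive S e × Meets (toℕ x) e

  private
    Free : VSet → ℕ → Set
    Free S v = ∀ u → T (S u) → ¬ Near (toℕ u) v

    T∧⁻ : ∀ {a b} → T (a ∧ b) → T a × T b
    T∧⁻ = Equivalence.to Bool.T-∧

    T∧⁺ : ∀ {a b} → T a → T b → T (a ∧ b)
    T∧⁺ ta tb = Equivalence.from Bool.T-∧ (ta , tb)

    T∨⁻ : ∀ {a b} → T (a ∨ b) → T a ⊎ T b
    T∨⁻ = Equivalence.to Bool.T-∨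

    T∨⁺ : ∀ {a b} → T a ⊎ T b → T (a ∨ b)
    T∨⁺ = Equivalence.from Bool.T-∨

    T-not⁻ : ∀ {a} → T (not a) → ¬ T a
    T-not⁻ {true} ()

    T-not⁺ : ∀ {a} → ¬ T a → T (not a)
    T-not⁺ {true}  ¬ta = ¬ta tt
    T-not⁺ {false} _   = tt

    anyV⁻ : ∀ {p} → T (anyV p) → ∃ λ u → T (p u)
    anyV⁻ {p} h = satisfied (any⁻ p (allFin N) h)

    anyV⁺ : ∀ {p} u → T (p u) → T (anyV p)
    anyV⁺ {p} u pu = any⁺ p (lose (∈-allFin u) pu)

    adj⁻ : ∀ {u v : V} → T (pathAdj u v) → suc (toℕ u) ≡ toℕ v ⊎ suc (toℕ v) ≡ toℕ u
    adj⁻ {u} {v} a with T∨⁻ {suc (toℕ u) ≡ᵇ toℕ v} a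
    ... | inj₁ e = inj₁ (≡ᵇ⇒≡ _ _ e)
    ... | inj₂ e = inj₂ (≡ᵇ⇒≡ _ _ e)

    adj⁺ : ∀ {u v : V} → suc (toℕ u) ≡ toℕ v ⊎ suc (toℕ v) ≡ toℕ u → T (pathAdj u v)
    adj⁺ {u} {v} (inj₁ e) = T∨⁺ {suc (toℕ u) ≡ᵇ toℕ v} (inj₁ (≡⇒≡ᵇ _ _ e))
    adj⁺ {u} {v} (inj₂ e) = T∨⁺ {suc (toℕ u) ≡ᵇ toℕ v} (inj₂ (≡⇒≡ᵇ _ _ e))

    near⁻ : ∀ {u v : V} → T (eqᵇ u v ∨ pathAdj u v) → Near (toℕ u) (toℕ v)
    near⁻ {u} {v} h with T∨⁻ {eqᵇ u v} h
    ... | inj₁ e = inj₁ (cong toℕ (toWitness e))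
    ... | inj₂ a = inj₂ (adj⁻ a)

    near⁺ : ∀ {u v : V} → Near (toℕ u) (toℕ v) → T (eqᵇ u v ∨ pathAdj u v)
    near⁺ {u} {v} (inj₁ e) = T∨⁺ {eqᵇ u v} (inj₁ (fromWitness (toℕ-injective e)))
    near⁺ {u} {v} (inj₂ a) = T∨⁺ {eqᵇ u v} (inj₂ (adj⁺ a))

    free⁻ : ∀ {S v} → T (free S v) → Free S (toℕ v)
    free⁻ h u su near = T-not⁻ h (anyV⁺ u (T∧⁺ su (near⁺ near)))

    free⁺ : ∀ {S v} → Free S (toℕ v) → T (free S v)
    free⁺ {S} fr = T-not⁺ λ h → let u , su∧near = anyV⁻ h
                                    su , near = T∧⁻ {S u} su∧near
                                in fr u su (near⁻ near)

    FreeNeighbour : VSet → V → Set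
    FreeNeighbour S y = ∃ λ w → T (free S w) × T (pathAdj y w)

    reach⁻ : ∀ {S} k {y z} → T (reach S k y z) → y ≡ z ⊎ FreeNeighbour S y
    reach⁻ zero h = inj₁ (toWitness h)
    reach⁻ {S} (suc k) {y} {z} h with T∨⁻ {reach S k y z} h
    ... | inj₁ r = reach⁻ k r
    ... | inj₂ step with anyV⁻ step
    ...   | w , r∧fz∧a with T∧⁻ {reach S k y w} r∧fz∧a
    ...     | r , fz∧a with reach⁻ k r
    ...       | inj₁ refl = inj₂ (z , T∧⁻ fz∧a)
    ...       | inj₂ fn   = inj₂ fn

    reach-refl : ∀ {S} k y → T (reach S k y y)
    reach-refl zero    y = fromWitness refl
    reach-refl (suc k) y = T∨⁺ (inj₁ (reach-refl k y))

    nontrivial⁻ : ∀ {S y} → T (inNontrivialComp S y) → T (free S y) × FreeNeighbour S y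
    nontrivial⁻ {S} {y} h with T∧⁻ {free S y} h
    ... | fy , ∃z with anyV⁻ ∃z
    ...   | z , r∧∃w with T∧⁻ {reach S N y z} r∧∃w
    ...     | r , ∃w with reach⁻ N r | anyV⁻ ∃w
    ...       | inj₁ refl | w , fw∧a = fy , w , T∧⁻ fw∧a
    ...       | inj₂ fn   | _        = fy , fn

    nontrivial⁺ : ∀ {S y w} → T (free S y) → T (free S w) → T (pathAdj y w) → T (inNontrivialComp S y)
    nontrivial⁺ {y = y} {w} fy fw a = T∧⁺ fy (anyV⁺ y (T∧⁺ (reach-refl N y) (anyV⁺ w (T∧⁺ fw a))))

    edge-alive : ∀ {S} {a b : V} → T (free S a) → T (free S b) → suc (toℕ a) ≡ toℕ b → Alive S (toℕ a)
    edge-alive {S} {a} {b} fa fb ab = subst (_≤ N) (cong suc (sym ab)) (toℕ<n b) , no-meet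
      where
      no-meet : ∀ u → T (S u) → ¬ Meets (toℕ u) (toℕ a)
      no-meet u su m with Meets⇒Near _ _ m
      ... | inj₁ near = free⁻ fa u su near
      ... | inj₂ near = free⁻ fb u su (subst (Near (toℕ u)) ab near)

  legal⁻ : ∀ {S x} → T (legal S x) → Legal S x
  legal⁻ {S} {x} h with anyV⁻ h
  ... | y , nt∧near with T∧⁻ {inNontrivialComp S y} nt∧near
  ...   | nt , xy with nontrivial⁻ nt | near⁻ {x} {y} xy
  ...     | fy , w , fw , a | near with adj⁻ a
  ...       | inj₁ yw = toℕ y , edge-alive fy fw yw , Near⇒Meets (inj₁ near)
  ...       | inj₂ wy = toℕ w , edge-alive fw fy wy , Near⇒Meets (inj₂ (subst (Near (toℕ x)) (sym wy) near))

  legal⁺ : ∀ {S x} → Legal S x → T (legal S x)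
  legal⁺ {S} {x} (e , (bound , no-meet) , meets) =
    [ (λ near → via fa fb (adj⁺ (inj₁ ab)) (subst (Near (toℕ x)) (sym ta) near))
    , (λ near → via fb fa (adj⁺ (inj₂ ab)) (subst (Near (toℕ x)) (sym tb) near))
    ] (Meets⇒Near _ _ meets)
    where
    a b : V
    a = fromℕ< (≤-trans (n≤1+n _) bound)
    b = fromℕ< bound
    ta : toℕ a ≡ e
    ta = toℕ-fromℕ< _
    tb : toℕ b ≡ suc e
    tb = toℕ-fromℕ< _
    ab : suc (toℕ a) ≡ toℕ b
    ab = trans (cong suc ta) (sym tb)
    fa : T (free S a)
    fa = free⁺ λ u su near → no-meet u su (Near⇒Meets (inj₁ (subst (Near (toℕ u)) ta near)))
    fb : T (free S b)
    fb = free⁺ λ u su near → no-meet u su (Near⇒Meets (inj₂ (subst (Near (toℕ u)) tb near)))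
    via : ∀ {y w} → T (free S y) → T (free S w) → T (pathAdj y w) → Near (toℕ x) (toℕ y) → T (legal S x)
    via {y} fy fw yw xy = anyV⁺ y (T∧⁺ (nontrivial⁺ fy fw yw) (near⁺ xy))

  insert⁻ : ∀ {x S u} → T (insert x S u) → u ≡ x ⊎ T (S u)
  insert⁻ {x} {S} {u} h with T∨⁻ {eqᵇ u x} h
  ... | inj₁ e  = inj₁ (toWitness e)
  ... | inj₂ su = inj₂ su

  insert-self : ∀ {x S} → T (insert x S x)
  insert-self {x} = T∨⁺ {eqᵇ x x} (inj₁ (fromWitness refl))

  insert-⊇ : ∀ {x S u} → T (S u) → T (insert x S u)
  insert-⊇ {x} {S} {u} su = T∨⁺ {eqᵇ u x} (inj₂ su)

  alive-insert⁻ : ∀ {x S e} → Alive (insert x S) e → Alive S e × ¬ Meets (toℕ x) e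
  alive-insert⁻ {x} {S} (bound , no-meet) = (bound , λ u su → no-meet u (insert-⊇ {x} {S} su)) , no-meet x (insert-self {x} {S})

  alive-insert⁺ : ∀ {x S e} → Alive S e → ¬ Meets (toℕ x) e → Alive (insert x S) e
  alive-insert⁺ {x} {S} {e} (bound , no-meet) ¬meets = bound , no-meet′
    where
    no-meet′ : ∀ u → T (insert x S u) → ¬ Meets (toℕ u) e
    no-meet′ u su with insert⁻ {x} {S} {u} su
    ... | inj₁ refl = ¬meets
    ... | inj₂ su′  = no-meet u su′

-- Staller's strategy: lower bounds

module Chips (N : ℕ) where

  open PathGame N

  vertex : (m : ℕ) → m < N → V
  vertex m m<N = fromℕ< m<N

  meets-vertex : ∀ {m e} (m<N : m < N) → Meets m e → Meets (toℕ (vertex m m<N)) e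
  meets-vertex {e = e} m<N = subst (λ v → Meets v e) (sym (toℕ-fromℕ< m<N))

  alive<N : ∀ {S e} → Alive S e → e < N
  alive<N (bound , _) = ≤-trans (n≤1+n _) bound

  blocker : ∀ {S e} → 2 + e ≤ N → ¬ Alive S e → ∃ λ s → T (S s) × Meets (toℕ s) e
  blocker {S} {e} bound dead with any? (λ s → T? (S s) ×-dec meets? (toℕ s) e)
  ... | yes found = found
  ... | no none   = contradiction (bound , λ s ss m → none (s , ss , m)) dead

  KillsOnly : VSet → V → ℕ → Set
  KillsOnly S x c = Alive S c × Meets (toℕ x) c × (∀ {e} → Alive S e → Meets (toℕ x) e → e ≡ c)

  Chip : VSet → ℕ → Set
  Chip S c = ∃ λ x → KillsOnly S x c

  chip-after-dead : ∀ {S c} → ¬ Alive S c → Alive S (suc c) → Chip S (suc c)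
  chip-after-dead {S} {c} dead alive@(bound , _) with blocker (≤-trans (n≤1+n _) bound) dead
  ... | s , ss , meets-c = vertex c c<N , alive , meets-vertex c<N (m≤n+m c 3 , ≤-refl) , only
    where
    c<N : c < N
    c<N = ≤-trans (n≤1+n _) (≤-trans (n≤1+n _) bound)
    c≡1+s : c ≡ suc (toℕ s)
    c≡1+s = meets-left-end meets-c (proj₂ alive s ss)
    only : ∀ {e} → Alive S e → Meets (toℕ (vertex c c<N)) e → e ≡ suc c
    only {e} (_ , no-meet) m = trans (meets-only-suc (subst (λ v → Meets v e) (trans (toℕ-fromℕ< c<N) c≡1+s) m) (no-meet s ss))
                                     (cong suc (sym c≡1+s))

  chip-before-dead : ∀ {S c} → Alive S c → 3 + c ≤ N → ¬ Alive S (suc c) → Chip S c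
  chip-before-dead {S} {c} alive bound dead with blocker bound dead
  ... | s , ss , meets-c₊ = vertex (2 + c) bound , alive , meets-vertex bound (≤-refl , m≤n+m c 3) , only
    where
    s≡3+c : toℕ s ≡ 3 + c
    s≡3+c = meets-right-end meets-c₊ (proj₂ alive s ss)
    only : ∀ {e} → Alive S e → Meets (toℕ (vertex (2 + c) bound)) e → e ≡ c
    only {e} (_ , no-meet) m = suc-injective (suc-injective (sym (meets-only-pred
      (subst (λ v → Meets v e) (toℕ-fromℕ< bound) m) (subst (λ v → ¬ Meets v e) s≡3+c (no-meet s ss)))))

  chip-above : ∀ {S d p} → d < p → ¬ Alive S d → Alive S p → ∃ λ c → d < c × Chip S c
  chip-above {S} d<p dead alive with crossing (alive? S) (<⇒≤ d<p) dead alive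
  ... | c , d≤c , _ , dead-c , alive-c₊ = suc c , s≤s d≤c , chip-after-dead dead-c alive-c₊

  chip-below : ∀ {S d p} → p < d → 2 + d ≤ N → ¬ Alive S d → Alive S p → ∃ (Chip S)
  chip-below {S} p<d bound dead alive with crossing (¬? ∘ alive? S) (<⇒≤ p<d) (λ ¬alive → ¬alive alive) dead
  ... | c , _ , c<d , ¬dead-c , dead-c₊ =
    c , chip-before-dead (decidable-stable (alive? S c) ¬dead-c) (≤-trans (s≤s (s≤s c<d)) bound) dead-c₊

  -- The edge u ∸ 1 is destroyed by u, so some live edge lies next to a destroyed one.
  staller-can-chip : ∀ {S u p} → T (S u) → Alive S p → ∃ (Chip S)
  staller-can-chip {S} {u} {p} su alive = by-position (<-cmp d p)
    where
    d : ℕ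
    d = toℕ u ∸ 1
    dead : ¬ Alive S d
    dead (_ , no-meet) = no-meet u su (≤-trans (m≤n+m∸n (toℕ u) 1) (n≤1+n _) , ≤-trans (m∸n≤m (toℕ u) 1) (n≤1+n _))
    real : 2 + d ≤ N
    real with toℕ u | toℕ<n u
    ... | zero  | _   = ≤-trans (s≤s (s≤s z≤n)) (proj₁ alive)
    ... | suc _ | u<N = u<N
    by-position : Tri (d < p) (d ≡ p) (p < d) → ∃ (Chip S)
    by-position (tri< d<p _ _) = let c , _ , chip = chip-above d<p dead alive in c , chip
    by-position (tri≈ _ refl _) = contradiction alive dead
    by-position (tri> _ _ p<d) = chip-below p<d real dead alive

module LiveEdges (N : ℕ) where

  open PathGame N
  open Chips N

  live : VSet → ℕ
  live S = count (alive? S) N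

  live≡0⊎alive : ∀ S → live S ≡ 0 ⊎ ∃ (Alive S)
  live≡0⊎alive S with live S in eq
  ... | zero  = inj₁ refl
  ... | suc _ = inj₂ (let e , _ , alive = count>0⇒∃ (alive? S) N (subst (0 <_) (sym eq) (s≤s z≤n)) in e , alive)

  live≥1 : ∀ {S e} → Alive S e → 1 ≤ live S
  live≥1 {S} alive = count≥1 (alive? S) alive (alive<N alive)

  live-insert-< : ∀ {S x} → Legal S x → live (insert x S) < live S
  live-insert-< {S} {x} (e , alive , meets) =
    count-strict (alive? S) (alive? (insert x S)) (proj₁ ∘ alive-insert⁻ {x} {S})
                 alive (λ alive′ → proj₂ (alive-insert⁻ {x} {S} alive′) meets) (alive<N alive)

  live-insert-≥ : ∀ S x → live S ∸ 4 ≤ live (insert x S)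
  live-insert-≥ S x = m≤n+o⇒m∸n≤o (live S) 4
    (≤-trans (count-∪ (alive? S) (alive? (insert x S)) (meets? (toℕ x)) survives N)
             (≤-trans (+-monoʳ-≤ _ window) (≤-reflexive (+-comm _ 4))))
    where
    survives : ∀ {e} → Alive S e → Alive (insert x S) e ⊎ Meets (toℕ x) e
    survives {e} alive with meets? (toℕ x) e
    ... | yes meets = inj₂ meets
    ... | no ¬meets = inj₁ (alive-insert⁺ {x} {S} alive ¬meets)
    width : ∀ u → 2 + u ∸ (u ∸ 2) ≤ 4
    width 0 = s≤s (s≤s z≤n)
    width 1 = s≤s (s≤s (s≤s z≤n))
    width (suc (suc u)) = ≤-reflexive (m+n∸n≡m 4 u)
    window : count (meets? (toℕ x)) N ≤ 4
    window = ≤-trans (count-interval (meets? (toℕ x)) N (λ _ (x≤ , e≤) → m≤n+o⇒m∸n≤o (toℕ x) 2 x≤ , s≤s e≤))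
                     (width (toℕ x))

  live-chip : ∀ {S x c} → KillsOnly S x c → live S ≡ suc (live (insert x S))
  live-chip {S} {x} {c} (alive , meets , only) =
    count-remove-one (alive? S) (alive? (insert x S)) (proj₁ ∘ alive-insert⁻ {x} {S}) killed alive
                     (λ alive′ → proj₂ (alive-insert⁻ {x} {S} alive′) meets) (alive<N alive)
    where
    killed : ∀ {e} → Alive S e → Alive (insert x S) e ⊎ e ≡ c
    killed {e} alive-e with meets? (toℕ x) e
    ... | yes meets-e = inj₂ (only alive-e meets-e)
    ... | no ¬meets-e = inj₁ (alive-insert⁺ {x} {S} alive-e ¬meets-e)

module StallerStrategy (N : ℕ) where

  open PathGame N
  open GameValue (P N)
  open Chips N
  open LiveEdges N

  some-legal : ∀ {S e} → Alive S e → ∃ (Legal S)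
  some-legal {e = e} alive = vertex e (alive<N alive) , e , alive , meets-vertex (alive<N alive) (m≤n+m e 2 , n≤1+n e)

  kills-legal : ∀ {S x c} → KillsOnly S x c → Legal S x
  kills-legal {c = c} (alive , meets , _) = c , alive , meets

  mutual
    dominator-lower : ∀ k S → live S ≤ k → movesD (live S) ≤ value k true S
    dominator-lower zero S fuel rewrite n≤0⇒n≡0 fuel = z≤n
    dominator-lower (suc k) S fuel with live≡0⊎alive S
    ... | inj₁ over = ≤-trans (≤-reflexive (cong movesD over)) z≤n
    ... | inj₂ (_ , alive) with some-legal alive
    ...   | x , x-legal =
      ≤-trans (movesD≤1+movesS[m∸4] (live S)) (dominator-≥ {x = x} (movesS (live S ∸ 4)) (legal⁺ {S} {x} x-legal) reply)
      where
      reply : ∀ y → T (legal S y) → movesS (live S ∸ 4) ≤ value k false (insert y S)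
      reply y legal-y = ≤-trans (movesS-mono (live-insert-≥ S y))
        (staller-lower k (insert y S) (s≤s⁻¹ (≤-trans (live-insert-< (legal⁻ legal-y)) fuel)) (y , insert-self {y} {S}))

    staller-lower : ∀ k S → live S ≤ k → (∃ λ u → T (S u)) → movesS (live S) ≤ value k false S
    staller-lower zero S fuel _ rewrite n≤0⇒n≡0 fuel = z≤n
    staller-lower (suc k) S fuel (u , su) with live≡0⊎alive S
    ... | inj₁ over = ≤-trans (≤-reflexive (cong movesS over)) z≤n
    ... | inj₂ (_ , alive) with staller-can-chip su alive
    ...   | c , x , kills = begin
      movesS (live S)                          ≡⟨ cong movesS (live-chip kills) ⟩
      movesS (suc (live (insert x S)))         ≡⟨ movesS-suc (live (insert x S)) ⟩
      suc (movesD (live (insert x S)))         ≤⟨ s≤s (dominator-lower k (insert x S) fuel′) ⟩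
      suc (value k true (insert x S))          ≤⟨ staller-≥ (legal⁺ {S} {x} (kills-legal kills)) ⟩
      value (suc k) false S                    ∎
      where
      open ≤-Reasoning
      fuel′ : live (insert x S) ≤ k
      fuel′ = s≤s⁻¹ (subst (_≤ suc k) (live-chip kills) fuel)

  -- The vertex that destroyed edge 1 but spared edge 0 is 3, which also destroyed edges 2 to 4.
  isolated-kill : ∀ {S y} → Alive S 0 → ¬ Alive S 1 → Meets (toℕ y) 0 → KillsOnly S y 0
  isolated-kill {S} {y} alive0 dead1 meets0 = alive0 , meets0 , only
    where
    only : ∀ {e} → Alive S e → Meets (toℕ y) e → e ≡ 0
    only {zero}  _                    _        = refl
    only {suc e} (bound , no-meet) (_ , e≤1+y) with blocker (≤-trans (s≤s (s≤s (s≤s z≤n))) bound) dead1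
    ... | s , ss , meets1 = contradiction (subst (λ v → Meets v (suc e)) (sym s≡3) (s≤s (s≤s (s≤s z≤n)) , e≤3))
                                          (no-meet s ss)
      where
      s≡3 : toℕ s ≡ 3
      s≡3 = meets-right-end meets1 (proj₂ alive0 s ss)
      e≤3 : suc e ≤ 4
      e≤3 = ≤-trans e≤1+y (s≤s (≤-trans (proj₁ meets0) (n≤1+n _)))

  mutual
    dominator-lower-isolated : ∀ k S → live S ≤ k → Alive S 0 → ¬ Alive S 1 →
                               suc (movesD (live S ∸ 1)) ≤ value k true S
    dominator-lower-isolated zero    S fuel alive0 _ = contradiction (≤-trans (live≥1 alive0) fuel) λ ()
    dominator-lower-isolated (suc k) S fuel alive0 dead1 with some-legal alive0
    ... | x , x-legal = dominator-≥ {x = x} (movesD (live S ∸ 1)) (legal⁺ {S} {x} x-legal) reply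
      where
      fuel′ : ∀ y → T (legal S y) → live (insert y S) ≤ k
      fuel′ y legal-y = s≤s⁻¹ (≤-trans (live-insert-< (legal⁻ legal-y)) fuel)

      reply : ∀ y → T (legal S y) → movesD (live S ∸ 1) ≤ value k false (insert y S)
      reply y legal-y with meets? (toℕ y) 0
      ... | yes meets0 = begin
        movesD (live S ∸ 1)           ≡⟨ cong (λ m → movesD (m ∸ 1)) (live-chip (isolated-kill alive0 dead1 meets0)) ⟩
        movesD (live (insert y S))    ≤⟨ movesD≤movesS (live (insert y S)) ⟩
        movesS (live (insert y S))    ≤⟨ staller-lower k (insert y S) (fuel′ y legal-y) (y , insert-self {y} {S}) ⟩
        value k false (insert y S)    ∎
        where open ≤-Reasoning
      ... | no ¬meets0 = begin
        movesD (live S ∸ 1)                  ≤⟨ movesD≤1+movesS[m∸4] (live S ∸ 1) ⟩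
        suc (movesS (live S ∸ 1 ∸ 4))        ≤⟨ s≤s (movesS-mono shrink) ⟩
        suc (movesS (live (insert y S) ∸ 1)) ≤⟨ staller-lower-isolated k (insert y S) (fuel′ y legal-y)
                                                  (alive-insert⁺ {y} {S} alive0 ¬meets0)
                                                  (dead1 ∘ proj₁ ∘ alive-insert⁻ {y} {S}) ⟩
        value k false (insert y S)           ∎
        where
        open ≤-Reasoning
        shrink : live S ∸ 1 ∸ 4 ≤ live (insert y S) ∸ 1
        shrink = subst (_≤ live (insert y S) ∸ 1) (trans (∸-+-assoc (live S) 4 1) (sym (∸-+-assoc (live S) 1 4)))
                       (∸-monoˡ-≤ 1 (live-insert-≥ S y))

    staller-lower-isolated : ∀ k S → live S ≤ k → Alive S 0 → ¬ Alive S 1 →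
                             suc (movesS (live S ∸ 1)) ≤ value k false S
    staller-lower-isolated zero    S fuel alive0 _ = contradiction (≤-trans (live≥1 alive0) fuel) λ ()
    staller-lower-isolated (suc k) S fuel alive0 dead1 with 2 ≤? live S
    ... | no live<2 with some-legal alive0
    ...   | x , x-legal =
      ≤-trans (s≤s (≤-trans (≤-reflexive (cong movesS (m≤n⇒m∸n≡0 (s≤s⁻¹ (≰⇒> live<2))))) z≤n))
              (staller-≥ {x = x} (legal⁺ {S} {x} x-legal))
    staller-lower-isolated (suc k) S fuel alive0 dead1 | yes live≥2 with count≥2⇒∃≢ (alive? S) 0 N live≥2
    ... | p , alive-p , p≢0 with chip-above (beyond-1 p alive-p p≢0) dead1 alive-p
      where
      beyond-1 : ∀ p → Alive S p → p ≢ 0 → 1 < p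
      beyond-1 zero          _       p≢0 = contradiction refl p≢0
      beyond-1 (suc zero)    alive-1 _   = contradiction alive-1 dead1
      beyond-1 (suc (suc p)) _       _   = s≤s (s≤s z≤n)
    ...   | c , 1<c , x , kills = begin
      suc (movesS (live S ∸ 1))           ≡⟨ cong (λ m → suc (movesS (m ∸ 1))) (live-chip kills) ⟩
      suc (movesS (live S′))              ≡⟨ cong (suc ∘ movesS) (sym (trans (+-comm 1 _) (m∸n+n≡m (live≥1 alive0′)))) ⟩
      suc (movesS (suc (live S′ ∸ 1)))    ≡⟨ cong suc (movesS-suc (live S′ ∸ 1)) ⟩
      suc (suc (movesD (live S′ ∸ 1)))    ≤⟨ s≤s (dominator-lower-isolated k S′ fuel′ alive0′ dead1′) ⟩
      suc (value k true S′)               ≤⟨ staller-≥ (legal⁺ {S} {x} (kills-legal kills)) ⟩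
      value (suc k) false S               ∎
      where
      open ≤-Reasoning
      S′ : VSet
      S′ = insert x S
      alive0′ : Alive S′ 0
      alive0′ = alive-insert⁺ {x} {S} alive0 λ meets0 →
        contradiction (proj₂ (proj₂ kills) alive0 meets0) (<⇒≢ (<-trans z<s 1<c))
      dead1′ : ¬ Alive S′ 1
      dead1′ = dead1 ∘ proj₁ ∘ alive-insert⁻ {x} {S}
      fuel′ : live S′ ≤ k
      fuel′ = s≤s⁻¹ (subst (_≤ suc k) (live-chip kills) fuel)

-- The potential

sumBelow : ℕ → (ℕ → ℕ) → ℕ
sumBelow zero    f = 0
sumBelow (suc B) f = f B + sumBelow B f

sum-mono : ∀ B {f g : ℕ → ℕ} → (∀ t → f t ≤ g t) → sumBelow B f ≤ sumBelow B g
sum-mono zero    f≤g = z≤n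
sum-mono (suc B) f≤g = +-mono-≤ (f≤g B) (sum-mono B f≤g)

sum-subadditive : ∀ B {f g h : ℕ → ℕ} → (∀ t → f t ≤ g t + h t) → sumBelow B f ≤ sumBelow B g + sumBelow B h
sum-subadditive zero    _  = z≤n
sum-subadditive (suc B) {f} {g} {h} f≤g+h =
  ≤-trans (+-mono-≤ (f≤g+h B) (sum-subadditive B f≤g+h)) (≤-reflexive (interchange (g B) (h B) _ _))

sum-drop : ∀ {B f g s} d → (∀ t → f t ≤ g t) → s < B → f s + d ≤ g s → sumBelow B f + d ≤ sumBelow B g
sum-drop {suc B} {f} {g} {s} d f≤g (s≤s s≤B) drop with m≤n⇒m<n∨m≡n s≤B
... | inj₁ s<B = begin
  f B + sumBelow B f + d   ≡⟨ +-assoc (f B) _ d ⟩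
  f B + (sumBelow B f + d) ≤⟨ +-mono-≤ (f≤g B) (sum-drop d f≤g s<B drop) ⟩
  g B + sumBelow B g       ∎
  where open ≤-Reasoning
... | inj₂ refl = begin
  f s + sumBelow s f + d   ≡⟨ trans (+-assoc (f s) _ d) (trans (cong (f s +_) (+-comm _ d)) (sym (+-assoc (f s) d _))) ⟩
  f s + d + sumBelow s f   ≤⟨ +-mono-≤ drop (sum-mono s f≤g) ⟩
  g s + sumBelow s g       ∎
  where open ≤-Reasoning

term≤sum : ∀ {B f t} → t < B → f t ≤ sumBelow B f
term≤sum {suc B} {f} (s≤s t≤B) with m≤n⇒m<n∨m≡n t≤B
... | inj₁ t<B  = ≤-trans (term≤sum t<B) (m≤n+m _ (f B))
... | inj₂ refl = m≤m+n _ _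

sum-zero : ∀ B {f} → (∀ t → t < B → f t ≡ 0) → sumBelow B f ≡ 0
sum-zero zero    _     = refl
sum-zero (suc B) zeros = cong₂ _+_ (zeros B ≤-refl) (sum-zero B λ t t<B → zeros t (m<n⇒m<1+n t<B))

sum-single : ∀ B {f s} → (∀ t → t ≢ s → f t ≡ 0) → sumBelow B f ≤ f s
sum-single zero    _    = z≤n
sum-single (suc B) {f} {s} zero-elsewhere with B ≟ s
... | yes refl = ≤-reflexive (trans (cong (f B +_) (sum-zero B λ t t<B → zero-elsewhere t (<⇒≢ t<B))) (+-identityʳ _))
... | no B≢s   = subst (_≤ f s) (cong (_+ sumBelow B f) (sym (zero-elsewhere B B≢s))) (sum-single B zero-elsewhere)

⊓-subadditive : ∀ m a b → m ⊓ (a + b) ≤ m ⊓ a + m ⊓ b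
⊓-subadditive m a b with ≤-total m a | ≤-total m b
... | inj₁ m≤a | _       = ≤-trans (m⊓n≤m m _) (≤-trans (≤-reflexive (sym (m≤n⇒m⊓n≡m m≤a))) (m≤m+n _ _))
... | inj₂ _   | inj₁ m≤b = ≤-trans (m⊓n≤m m _) (≤-trans (≤-reflexive (sym (m≤n⇒m⊓n≡m m≤b))) (m≤n+m _ _))
... | inj₂ a≤m | inj₂ b≤m =
  ≤-trans (m⊓n≤n m _) (≤-reflexive (sym (cong₂ _+_ (m≥n⇒m⊓n≡n a≤m) (m≥n⇒m⊓n≡n b≤m))))

5*suc : ∀ s → 5 * suc s ≡ 5 * s + 5
5*suc s = trans (*-suc 5 s) (+-comm 5 (5 * s))

block-unique : ∀ {s t i} → i < 5 → 5 * s ≤ 5 * t + i → 5 * t + i < 5 * s + 5 → t ≡ s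
block-unique {s} {t} {i} i<5 lower upper =
  ≤-antisym (s≤s⁻¹ (*-cancelˡ-< 5 t (suc s) t<1+s)) (s≤s⁻¹ (*-cancelˡ-< 5 s (suc t) s<1+t))
  where
  t<1+s : 5 * t < 5 * suc s
  t<1+s = ≤-trans (s≤s (m≤m+n (5 * t) i)) (≤-trans upper (≤-reflexive (sym (5*suc s))))
  s<1+t : 5 * s < 5 * suc t
  s<1+t = ≤-<-trans lower (<-≤-trans (+-monoʳ-< (5 * t) i<5) (≤-reflexive (sym (5*suc t))))

atBlock : ∀ {P : ℕ → Set} → Decidable P → ∀ t → Decidable (λ i → P (5 * t + i))
atBlock P? t i = P? (5 * t + i)

blockCount : ∀ {P : ℕ → Set} → Decidable P → ℕ → ℕ
blockCount P? t = count (atBlock P? t) 5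

cost : ∀ {P : ℕ → Set} → Decidable P → ℕ → ℕ
cost P? t = 2 ⊓ blockCount P? t

Φ : ℕ → ∀ {P : ℕ → Set} → Decidable P → ℕ
Φ B P? = sumBelow B (cost P?)

module _ {P Q : ℕ → Set} (P? : Decidable P) (Q? : Decidable Q) where

  cost-mono : (∀ {c} → Q c → P c) → ∀ t → cost Q? t ≤ cost P? t
  cost-mono Q⊆P t = ⊓-monoʳ-≤ 2 (count-mono (atBlock Q? t) (atBlock P? t) 5 (λ _ → Q⊆P))

  Φ-mono : ∀ B → (∀ {c} → Q c → P c) → Φ B Q? ≤ Φ B P?
  Φ-mono B Q⊆P = sum-mono B (cost-mono Q⊆P)

  Φ-drop : ∀ B {t} d → (∀ {c} → Q c → P c) → t < B → cost Q? t + d ≤ cost P? t → Φ B Q? + d ≤ Φ B P?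
  Φ-drop B d Q⊆P = sum-drop d (cost-mono Q⊆P)

Φ-subadditive : ∀ B {P Q R : ℕ → Set} (P? : Decidable P) (Q? : Decidable Q) (R? : Decidable R) →
                (∀ {c} → P c → Q c ⊎ R c) → Φ B P? ≤ Φ B Q? + Φ B R?
Φ-subadditive B P? Q? R? P⊆Q∪R = sum-subadditive B λ t →
  ≤-trans (⊓-monoʳ-≤ 2 (count-∪ (atBlock P? t) (atBlock Q? t) (atBlock R? t) P⊆Q∪R 5))
          (⊓-subadditive 2 (blockCount Q? t) (blockCount R? t))

Φ-empty : ∀ B {P : ℕ → Set} (P? : Decidable P) → (∀ {c} → ¬ P c) → Φ B P? ≡ 0
Φ-empty B P? none = sum-zero B λ t _ → cong (2 ⊓_) (count-zero (atBlock P? t) 5 λ _ → none)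

Φ-in-block : ∀ B {P : ℕ → Set} (P? : Decidable P) {s lo r} →
             (∀ {c} → P c → InRange lo (lo + r) c) → 5 * s ≤ lo → lo + r ≤ 5 * s + 5 → Φ B P? ≤ 2 ⊓ r
Φ-in-block B P? {s} {lo} {r} inside s≤lo end = ≤-trans (sum-single B other-blocks) (⊓-monoʳ-≤ 2 in-block)
  where
  other-blocks : ∀ t → t ≢ s → cost P? t ≡ 0
  other-blocks t t≢s = cong (2 ⊓_) (count-zero (atBlock P? t) 5 λ i<5 p →
    t≢s (block-unique i<5 (≤-trans s≤lo (proj₁ (inside p))) (<-≤-trans (proj₂ (inside p)) end)))
  d : ℕ
  d = lo ∸ 5 * s
  lo≡5s+d : lo ≡ 5 * s + d
  lo≡5s+d = sym (m+[n∸m]≡n s≤lo)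
  in-block : blockCount P? s ≤ r
  in-block = ≤-trans (count-interval (atBlock P? s) {d} {d + r} 5 λ _ p →
      m≤n+o⇒m∸n≤o lo (5 * s) (proj₁ (inside p))
    , +-cancelˡ-< (5 * s) _ _ (<-≤-trans (proj₂ (inside p)) (≤-reflexive (trans (cong (_+ r) lo≡5s+d) (+-assoc (5 * s) d r)))))
    (≤-reflexive (m+n∸m≡n d r))

module _ {P : ℕ → Set} (P? : Decidable P) (v : ℕ) where

  below? : Decidable (λ c → P c × c < v)
  below? c = P? c ×-dec c <? v

  from? : Decidable (λ c → P c × v ≤ c)
  from? c = P? c ×-dec v ≤? c

  Φ-split : ∀ B → Φ B P? ≤ Φ B below? + Φ B from?
  Φ-split B = Φ-subadditive B P? below? from? split
    where
    split : ∀ {c} → P c → (P c × c < v) ⊎ (P c × v ≤ c)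
    split {c} p with c <? v
    ... | yes c<v = inj₁ (p , c<v)
    ... | no c≮v  = inj₂ (p , ≮⇒≥ c≮v)

Φ-from-block-start : ∀ B {P : ℕ → Set} (P? : Decidable P) L s →
                     (∀ {c} → P c → InRange (5 * s) (5 * s + L) c) → Φ B P? ≤ movesS L
Φ-from-block-start B P? 0 s inside = Φ-in-block B P? {s} inside ≤-refl (+-monoʳ-≤ (5 * s) (m≤m+n 0 5))
Φ-from-block-start B P? 1 s inside = Φ-in-block B P? {s} inside ≤-refl (+-monoʳ-≤ (5 * s) (m≤m+n 1 4))
Φ-from-block-start B P? 2 s inside = Φ-in-block B P? {s} inside ≤-refl (+-monoʳ-≤ (5 * s) (m≤m+n 2 3))
Φ-from-block-start B P? 3 s inside = Φ-in-block B P? {s} inside ≤-refl (+-monoʳ-≤ (5 * s) (m≤m+n 3 2))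
Φ-from-block-start B P? 4 s inside = Φ-in-block B P? {s} inside ≤-refl (+-monoʳ-≤ (5 * s) (m≤m+n 4 1))
Φ-from-block-start B P? (suc (suc (suc (suc (suc L))))) s inside = ≤-trans (Φ-split P? v B) (+-mono-≤ first rest)
  where
  v : ℕ
  v = 5 * s + 5
  first : Φ B (below? P? v) ≤ 2
  first = Φ-in-block B (below? P? v) {s} (λ (p , c<v) → proj₁ (inside p) , c<v) ≤-refl ≤-refl
  rest : Φ B (from? P? v) ≤ movesS L
  rest = Φ-from-block-start B (from? P? v) L (suc s) λ {c} (p , v≤c) →
      subst (_≤ c) (sym (5*suc s)) v≤c
    , <-≤-trans (proj₂ (inside p)) (≤-reflexive (trans (sym (+-assoc (5 * s) 5 L)) (cong (_+ L) (sym (5*suc s)))))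

Φ-in-last-block : ∀ B {P : ℕ → Set} (P? : Decidable P) {L lo s} → L ≤ 5 →
                  (∀ {c} → P c → InRange lo (5 * suc s) c) → lo + L ≡ 5 * suc s → Φ B P? ≤ 2 ⊓ L
Φ-in-last-block B P? {L} {lo} {s} L≤5 inside end =
  Φ-in-block B P? {s} (λ {c} p → proj₁ (inside p) , subst (c <_) (sym end) (proj₂ (inside p)))
    (+-cancelʳ-≤ L (5 * s) lo (≤-trans (+-monoʳ-≤ (5 * s) L≤5) (≤-reflexive (trans (sym (5*suc s)) (sym end)))))
    (≤-reflexive (trans end (5*suc s)))

Φ-to-block-end : ∀ B {P : ℕ → Set} (P? : Decidable P) L lo s →
                 (∀ {c} → P c → InRange lo (5 * s) c) → lo + L ≡ 5 * s → Φ B P? ≤ movesS L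
Φ-to-block-end B P? 0 lo s inside end = ≤-reflexive (Φ-empty B P? λ p →
  <-irrefl refl (<-≤-trans (proj₂ (inside p)) (≤-trans (≤-reflexive (trans (sym end) (+-identityʳ lo))) (proj₁ (inside p)))))
Φ-to-block-end B P? (suc L) lo zero inside end = contradiction (trans (sym (+-suc lo L)) end) λ ()
Φ-to-block-end B P? 1 lo (suc s) inside end = Φ-in-last-block B P? (m≤m+n 1 4) inside end
Φ-to-block-end B P? 2 lo (suc s) inside end = Φ-in-last-block B P? (m≤m+n 2 3) inside end
Φ-to-block-end B P? 3 lo (suc s) inside end = Φ-in-last-block B P? (m≤m+n 3 2) inside end
Φ-to-block-end B P? 4 lo (suc s) inside end = Φ-in-last-block B P? (m≤m+n 4 1) inside end
Φ-to-block-end B P? (suc (suc (suc (suc (suc L))))) lo (suc s) inside end =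
  ≤-trans (Φ-split P? v B) (≤-trans (+-mono-≤ rest last) (≤-reflexive (+-comm (movesS L) 2)))
  where
  v : ℕ
  v = 5 * s
  end′ : lo + L ≡ v
  end′ = +-cancelʳ-≡ 5 _ _ (trans (+-assoc lo L 5) (trans (cong (lo +_) (+-comm L 5)) (trans end (5*suc s))))
  rest : Φ B (below? P? v) ≤ movesS L
  rest = Φ-to-block-end B (below? P? v) L lo s (λ (p , c<v) → proj₁ (inside p) , c<v) end′
  last : Φ B (from? P? v) ≤ 2
  last = Φ-in-block B (from? P? v) {s} (λ {c} (p , v≤c) → v≤c , subst (c <_) (5*suc s) (proj₂ (inside p))) ≤-refl ≤-refl

module _ {P : ℕ → Set} (P? : Decidable P) {t : ℕ} where

  cost-full : ∀ {i i′} → P (5 * t + i) → P (5 * t + i′) → i′ ≢ i → i < 5 → i′ < 5 → cost P? t ≡ 2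
  cost-full Pi Pi′ i′≢i i<5 i′<5 = m≤n⇒m⊓n≡m (count≥2 (atBlock P? t) _ Pi Pi′ i′≢i i<5 i′<5)

  cost-empty : (∀ {i} → i < 5 → ¬ P (5 * t + i)) → cost P? t ≡ 0
  cost-empty none = cong (2 ⊓_) (count-zero (atBlock P? t) 5 none)

  cost-pos : ∀ {i} → i < 5 → P (5 * t + i) → 1 ≤ cost P? t
  cost-pos i<5 Pi = ⊓-monoʳ-≤ 2 (count≥1 (atBlock P? t) Pi i<5)

⊓2-strict : ∀ {a b} → a ≤ 1 → a < b → suc (2 ⊓ a) ≤ 2 ⊓ b
⊓2-strict {0} {suc b}       _ _         = s≤s z≤n
⊓2-strict {1} {suc (suc b)} _ _         = ≤-refl
⊓2-strict {1} {1}           _ (s≤s ())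
⊓2-strict {suc (suc _)}     (s≤s ()) _

-- Dominator's strategy: upper bounds

block-decomposition : ∀ c → ∃₂ λ t i → i < 5 × c ≡ 5 * t + i
block-decomposition c = c / 5 , c % 5 , m%n<n c 5 ,
  trans (m≡m%n+[m/n]*n c 5) (trans (+-comm (c % 5) _) (cong (_+ c % 5) (*-comm (c / 5) 5)))

Window : ℕ → ℕ → Set
Window a c = a ≤ c × c ≤ 3 + a

window? : ∀ a → Decidable (Window a)
window? a c = a ≤? c ×-dec c ≤? 3 + a

infixl 5 _∖_
_∖_ : ∀ {P : ℕ → Set} → Decidable P → ∀ a → Decidable (λ c → P c × ¬ Window a c)
(P? ∖ a) c = P? c ×-dec ¬? (window? a c)

block-rest-in-window : ∀ {a t p} → Window a p → InRange (5 * t) (5 * t + 5) p →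
                       ∃ λ u → ∀ {i} → i < 5 → ¬ Window a (5 * t + i) → Window u (5 * t + i)
block-rest-in-window {a} {t} {p} (a≤p , p≤3+a) (5t≤p , p<5t+5) with a ≤? 5 * t
... | yes a≤5t = 4 + a , above
  where
  above : ∀ {i} → i < 5 → ¬ Window a (5 * t + i) → Window (4 + a) (5 * t + i)
  above {i} i<5 outside with 5 * t + i ≤? 3 + a
  ... | yes inside = contradiction (≤-trans a≤5t (m≤m+n _ i) , inside) outside
  ... | no beyond  = ≰⇒> beyond , (begin
    5 * t + i   ≤⟨ +-mono-≤ (≤-trans 5t≤p p≤3+a) (s≤s⁻¹ i<5) ⟩
    3 + a + 4   ≡⟨ trans (+-assoc 3 a 4) (cong (3 +_) (+-comm a 4)) ⟩
    3 + (4 + a) ∎)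
    where open ≤-Reasoning
... | no a≰5t = 5 * t , below
  where
  below : ∀ {i} → i < 5 → ¬ Window a (5 * t + i) → Window (5 * t) (5 * t + i)
  below {i} i<5 outside = m≤m+n _ i , ≤-trans (+-monoʳ-≤ (5 * t) i≤3) (≤-reflexive (+-comm (5 * t) 3))
    where
    i≤3 : i ≤ 3
    i≤3 with i ≤? 3
    ... | yes i≤3 = i≤3
    ... | no i≰3  = contradiction (≤-trans a≤p (≤-trans p≤5t+4 (+-monoʳ-≤ (5 * t) (≰⇒> i≰3))) ,
                                   ≤-trans (+-monoʳ-≤ (5 * t) (s≤s⁻¹ i<5)) 5t+4≤3+a) outside
      where
      p≤5t+4 : p ≤ 5 * t + 4
      p≤5t+4 = s≤s⁻¹ (≤-trans p<5t+5 (≤-reflexive (+-suc (5 * t) 4)))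
      5t+4≤3+a : 5 * t + 4 ≤ 3 + a
      5t+4≤3+a = ≤-trans (≤-reflexive (+-comm (5 * t) 4)) (+-monoʳ-≤ 3 (≰⇒> a≰5t))

window-+ : ∀ m {j i} → Window j i → Window (m + j) (m + i)
window-+ m {j} {i} (j≤i , i≤3+j) = +-monoʳ-≤ m j≤i , ≤-trans (+-monoʳ-≤ m i≤3+j) (≤-reflexive (x∙yz≈y∙xz m 3 j))

window-+⁻ : ∀ m {j i} → Window (m + j) (m + i) → Window j i
window-+⁻ m {j} {i} (j≤i , i≤3+j) =
  +-cancelˡ-≤ m j i j≤i , +-cancelˡ-≤ m i (3 + j) (≤-trans i≤3+j (≤-reflexive (sym (x∙yz≈y∙xz m 3 j))))

cover-all-but-one : ∀ {i} → i < 5 → ∃₂ λ j k → Window j i × (∀ {i′} → i′ < 5 → i′ ≢ k → Window j i′)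
cover-all-but-one {i} i<5 with i ≟ 4
... | yes refl = 1 , 0 , (s≤s z≤n , ≤-refl) , λ i′<5 i′≢0 → n≢0⇒n>0 i′≢0 , s≤s⁻¹ i′<5
... | no i≢4   = 0 , 4 , (z≤n , ≤3 i<5 i≢4) , λ i′<5 i′≢4 → z≤n , ≤3 i′<5 i′≢4
  where
  ≤3 : ∀ {n} → n < 5 → n ≢ 4 → n ≤ 3
  ≤3 n<5 n≢4 = s≤s⁻¹ (≤∧≢⇒< (s≤s⁻¹ n<5) n≢4)

module WindowGame (lo hi : ℕ) (1≤lo : 1 ≤ lo) (lo≤hi : lo ≤ hi) where

  ValidWindow : ℕ → Set
  ValidWindow a = lo ≤ 2 + a × suc a ≤ hi

  Supported : (ℕ → Set) → Set
  Supported P = ∀ {c} → P c → lo ≤ c × c ≤ hi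

  blocks : ℕ
  blocks = suc hi

  clamp : ∀ u → ∃ λ a → ValidWindow a × (∀ {c} → lo ≤ c → c ≤ hi → Window u c → Window a c)
  clamp u with hi ≤? u
  ... | yes hi≤u = hi ∸ 1 , (≤-trans lo≤hi (≤-trans (m≤n+m∸n hi 1) (n≤1+n _)) , ≤-reflexive 1+[hi∸1]≡hi) ,
                   λ _ c≤hi (u≤c , _) → ≤-trans (m∸n≤m hi 1) (≤-trans hi≤u u≤c) ,
                                        ≤-trans c≤hi (≤-trans (m≤n+m∸n hi 1) (1+h≤3+h))
    where
    1+[hi∸1]≡hi : suc (hi ∸ 1) ≡ hi
    1+[hi∸1]≡hi = trans (+-comm 1 _) (m∸n+n≡m (≤-trans 1≤lo lo≤hi))
    1+h≤3+h : 1 + (hi ∸ 1) ≤ 3 + (hi ∸ 1)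
    1+h≤3+h = +-monoˡ-≤ (hi ∸ 1) (s≤s z≤n)
  ... | no hi≰u with lo ≤? u
  ...   | yes lo≤u = u , (≤-trans lo≤u (m≤n+m u 2) , ≰⇒> hi≰u) , λ _ _ w → w
  ...   | no lo≰u  = lo ∸ 1 , (≤-trans (m≤n+m∸n lo 1) (n≤1+n _) , ≤-trans (≤-reflexive 1+[lo∸1]≡lo) lo≤hi) ,
                     λ lo≤c _ (_ , c≤3+u) →
                       ≤-trans (m∸n≤m lo 1) lo≤c ,
                       ≤-trans c≤3+u (+-monoʳ-≤ 3 (s≤s⁻¹ (≤-trans (≰⇒> lo≰u) (≤-reflexive (sym 1+[lo∸1]≡lo)))))
    where
    1+[lo∸1]≡lo : suc (lo ∸ 1) ≡ lo
    1+[lo∸1]≡lo = trans (+-comm 1 _) (m∸n+n≡m 1≤lo)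

  block<blocks : ∀ {P : ℕ → Set} {t i} → Supported P → P (5 * t + i) → t < blocks
  block<blocks {t = t} {i} supported P-c = s≤s (≤-trans (m≤n*m t 5) (≤-trans (m≤m+n (5 * t) i) (proj₂ (supported P-c))))

  Reply : ∀ {P : ℕ → Set} → Decidable P → ℕ → Set
  Reply {P} P? a = ∃ λ a′ → ValidWindow a′ × (∃ λ c → Window a′ c × P c × ¬ Window a c) ×
                            Φ blocks (P? ∖ a ∖ a′) + 2 ≤ Φ blocks P?

  reply-clearing-block : ∀ {P : ℕ → Set} (P? : Decidable P) {a t i r} → Supported P →
                         Window a (5 * t + i) → P (5 * t + i) → i < 5 →
                         r < 5 → P (5 * t + r) → ¬ Window a (5 * t + r) → Reply P? a
  reply-clearing-block {P} P? {a} {t} {i} {r} supported win-i P-i i<5 r<5 P-r out-r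
    with block-rest-in-window {t = t} win-i (m≤m+n _ i , +-monoʳ-< (5 * t) i<5)
  ... | u , outside⇒u with clamp u
  ...   | a′ , valid , u⇒a′ = a′ , valid , (5 * t + r , covers r<5 P-r out-r , P-r , out-r) , cleared
    where
    covers : ∀ {r} → r < 5 → P (5 * t + r) → ¬ Window a (5 * t + r) → Window a′ (5 * t + r)
    covers r<5 P-r out-r = u⇒a′ (proj₁ (supported P-r)) (proj₂ (supported P-r)) (outside⇒u r<5 out-r)
    r≢i : r ≢ i
    r≢i refl = out-r win-i
    cleared : Φ blocks (P? ∖ a ∖ a′) + 2 ≤ Φ blocks P?
    cleared = Φ-drop P? (P? ∖ a ∖ a′) blocks {t} 2 (proj₁ ∘ proj₁) (block<blocks {t = t} supported P-i)
      (≤-reflexive (trans (cong (_+ 2) (cost-empty (P? ∖ a ∖ a′) {t} λ r<5 ((P-r , out-r) , out′-r) →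
                                                     out′-r (covers r<5 P-r out-r)))
                          (sym (cost-full P? {t} P-i P-r r≢i i<5 r<5))))

  reply-after-cleared-block : ∀ {P : ℕ → Set} (P? : Decidable P) {a t i p′} → Supported P → P (5 * t + i) → i < 5 →
                              (∀ {r} → r < 5 → ¬ (P (5 * t + r) × ¬ Window a (5 * t + r))) →
                              P p′ → ¬ Window a p′ → Reply P? a
  reply-after-cleared-block {P} P? {a} {t} {i} {p′} supported P-i i<5 cleared-t P-p′ out-p′ with block-decomposition p′
  ... | t′ , i′ , i′<5 , refl with cover-all-but-one i′<5
  ...   | j , k , win-i′ , covers-others with clamp (5 * t′ + j)
  ...     | a′ , valid , u⇒a′ =
    a′ , valid , (5 * t′ + i′ , in-a′ (window-+ (5 * t′) win-i′) P-p′ , P-p′ , out-p′) , drop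
    where
    P₁? : Decidable (λ c → P c × ¬ Window a c)
    P₁? = P? ∖ a
    P₂? : Decidable (λ c → (P c × ¬ Window a c) × ¬ Window a′ c)
    P₂? = P₁? ∖ a′
    in-a′ : ∀ {c} → Window (5 * t′ + j) c → P c → Window a′ c
    in-a′ w P-c = u⇒a′ (proj₁ (supported P-c)) (proj₂ (supported P-c)) w
    staller-drop : Φ blocks P₁? + 1 ≤ Φ blocks P?
    staller-drop = Φ-drop P? P₁? blocks {t} 1 proj₁ (block<blocks {t = t} supported P-i)
      (subst (λ x → x + 1 ≤ cost P? t) (sym (cost-empty P₁? {t} cleared-t)) (cost-pos P? {t} i<5 P-i))
    at-most-k : blockCount P₂? t′ ≤ 1
    at-most-k = count≤1 (atBlock P₂? t′) {k} 5 λ {i″} i″<5 ((P-i″ , _) , out′) →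
      decidable-stable (i″ ≟ k) λ i″≢k → out′ (in-a′ (window-+ (5 * t′) (covers-others i″<5 i″≢k)) P-i″)
    fewer : blockCount P₂? t′ < blockCount P₁? t′
    fewer = count-strict (atBlock P₁? t′) (atBlock P₂? t′) proj₁ (P-p′ , out-p′)
                         (λ (_ , out′) → out′ (in-a′ (window-+ (5 * t′) win-i′) P-p′)) i′<5
    dominator-drop : Φ blocks P₂? + 1 ≤ Φ blocks P₁?
    dominator-drop = Φ-drop P₁? P₂? blocks {t′} 1 proj₁ (block<blocks {t = t′} supported P-p′)
      (≤-trans (≤-reflexive (+-comm _ 1)) (⊓2-strict at-most-k fewer))
    drop : Φ blocks P₂? + 2 ≤ Φ blocks P?
    drop = ≤-trans (≤-reflexive (sym (+-assoc _ 1 1))) (≤-trans (+-monoˡ-≤ 1 dominator-drop) staller-drop)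

  -- If the block of p keeps a live cell, Dominator clears the whole block (its cost drops from 2 to 0);
  -- otherwise Staller's move already cost it 1, and Dominator covers four cells of another block.
  dominator-reply : ∀ {P : ℕ → Set} (P? : Decidable P) {a p} → Supported P → Window a p → P p →
                    (∀ {c} → P c → Window a c) ⊎ Reply P? a
  dominator-reply P? {a} {p} supported win-p P-p with block-decomposition p
  ... | t , i , i<5 , refl with anyUpTo? (atBlock (P? ∖ a) t) 5
  ... | yes (r , r<5 , P-r , out-r) = inj₂ (reply-clearing-block P? {t = t} supported win-p P-p i<5 r<5 P-r out-r)
  ... | no cleared-t with anyUpTo? (P? ∖ a) blocks
  ...   | yes (_ , _ , P-p′ , out-p′) =
    inj₂ (reply-after-cleared-block P? {t = t} supported P-p i<5 (λ r<5 P-r∖a → cleared-t (_ , r<5 , P-r∖a)) P-p′ out-p′)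
  ...   | no cleared = inj₁ λ {c} P-c → decidable-stable (window? a c) λ out →
    cleared (c , s≤s (proj₂ (supported P-c)) , P-c , out)

  Φ-pos : ∀ {P : ℕ → Set} (P? : Decidable P) {c} → Supported P → P c → 1 ≤ Φ blocks P?
  Φ-pos P? {c} supported P-c with block-decomposition c
  ... | t , i , i<5 , refl = ≤-trans (cost-pos P? {t} i<5 P-c) (term≤sum (block<blocks {t = t} supported P-c))

meets⇒window : ∀ {x e} → Meets x e → Window x (2 + e)
meets⇒window (x≤ , e≤) = x≤ , s≤s (s≤s e≤)

module DominatorStrategy (N j : ℕ) (2≤N : 2 ≤ N) where

  open PathGame N
  open GameValue (P N)
  open Chips N using (vertex)

  -- Edge e becomes cell K + e, and vertex x then covers the window of cells j + x, ..., j + x + 3.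
  K : ℕ
  K = 2 + j

  open WindowGame K (N + j) (s≤s z≤n) (+-monoˡ-≤ j 2≤N)

  Cell : VSet → ℕ → Set
  Cell S c = K ≤ c × Alive S (c ∸ K)

  cell? : ∀ S → Decidable (Cell S)
  cell? S c = K ≤? c ×-dec alive? S (c ∸ K)

  potential : VSet → ℕ
  potential S = Φ blocks (cell? S)

  cell-edge : ∀ {c} → K ≤ c → K + (c ∸ K) ≡ c
  cell-edge = m+[n∸m]≡n

  cell-supported : ∀ {S} → Supported (Cell S)
  cell-supported {S} {c} (K≤c , bound , _) =
    K≤c , subst (_≤ N + j) (trans (cong (2 +_) (+-comm (c ∸ K) j)) (cell-edge K≤c)) (+-monoˡ-≤ j bound)

  cell-of : ∀ {S e} → Alive S e → Cell S (K + e)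
  cell-of {S} {e} alive = m≤m+n K e , subst (Alive S) (sym (m+n∸m≡n K e)) alive

  window-of : ∀ {x e} → Meets x e → Window (j + x) (K + e)
  window-of {x} {e} meets = subst (Window (j + x)) (x∙yz≈y∙xz j 2 e) (window-+ j (meets⇒window meets))

  meets-of : ∀ {x e} → Window (j + x) (K + e) → Meets x e
  meets-of {x} {e} w with window-+⁻ j (subst (Window (j + x)) (sym (x∙yz≈y∙xz j 2 e)) w)
  ... | x≤ , e≤ = x≤ , s≤s⁻¹ (s≤s⁻¹ e≤)

  cell-insert⁻ : ∀ {x S c} → Cell (insert x S) c → Cell S c × ¬ Window (j + toℕ x) c
  cell-insert⁻ {x} {S} {c} (K≤c , alive) with alive-insert⁻ {x} {S} alive
  ... | alive-S , ¬meets = (K≤c , alive-S) , λ w → ¬meets (meets-of (subst (Window (j + toℕ x)) (sym (cell-edge K≤c)) w))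

  cell-insert⁺ : ∀ {x S c} → Cell S c → ¬ Window (j + toℕ x) c → Cell (insert x S) c
  cell-insert⁺ {x} {S} {c} (K≤c , alive) out =
    K≤c , alive-insert⁺ {x} {S} alive λ meets → out (subst (Window (j + toℕ x)) (cell-edge K≤c) (window-of meets))

  reply-vertex : ∀ {S x a′ c} → ValidWindow a′ → Window a′ c → Cell S c → ¬ Window (j + toℕ x) c →
           ∃ λ y → Legal (insert x S) y ×
                   (∀ {c} → Cell (insert y (insert x S)) c → (Cell S c × ¬ Window (j + toℕ x) c) × ¬ Window a′ c)
  reply-vertex {S} {x} {a′} {c} (K≤2+a′ , a′<N+j) in-a′ cell-c out-c = y , legal-y , paired
    where
    j≤a′ : j ≤ a′
    j≤a′ = +-cancelˡ-≤ 2 j a′ K≤2+a′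
    y : V
    y = vertex (a′ ∸ j) (+-cancelʳ-≤ j (suc (a′ ∸ j)) N
                           (subst (_≤ N + j) (cong suc (sym (m∸n+n≡m j≤a′))) a′<N+j))
    a′≡j+y : j + toℕ y ≡ a′
    a′≡j+y = trans (cong (j +_) (toℕ-fromℕ< _)) (m+[n∸m]≡n j≤a′)
    legal-y : Legal (insert x S) y
    legal-y = c ∸ K , proj₂ (cell-insert⁺ {x} {S} cell-c out-c) ,
              meets-of (subst₂ Window (sym a′≡j+y) (sym (cell-edge (proj₁ cell-c))) in-a′)
    paired : ∀ {c} → Cell (insert y (insert x S)) c → (Cell S c × ¬ Window (j + toℕ x) c) × ¬ Window a′ c
    paired cell₂ with cell-insert⁻ {y} {insert x S} cell₂
    ... | cell₁ , out-y = cell-insert⁻ {x} {S} cell₁ , subst (λ a → ¬ Window a _) a′≡j+y out-y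

  staller-upper : ∀ k S → value k false S ≤ potential S
  staller-upper zero    S = z≤n
  staller-upper (suc k) S = staller-≤ (potential S) λ x legal-x → after-staller k x (legal⁻ legal-x)
    where
    after-staller : ∀ k x → Legal S x → suc (value k true (insert x S)) ≤ potential S
    after-staller zero x (e , alive , _) = Φ-pos (cell? S) cell-supported (cell-of alive)
    after-staller (suc k) x (e , alive , meets)
      with dominator-reply (cell? S) cell-supported (window-of meets) (cell-of alive)
    ... | inj₁ cleared =
      subst (λ v → suc v ≤ potential S) (sym (value-over no-move)) (Φ-pos (cell? S) cell-supported (cell-of alive))
      where
      no-move : ∀ y → ¬ T (legal (insert x S) y)
      no-move y legal-y with legal⁻ {insert x S} {y} legal-y
      ... | _ , alive′ , _ with cell-insert⁻ {x} {S} (cell-of alive′)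
      ...   | cell , out = out (cleared cell)
    ... | inj₂ (a′ , valid , (c , in-a′ , cell-c , out-c) , drop) with reply-vertex {S} {x} valid in-a′ cell-c out-c
    ...   | y , legal-y , paired = begin
      suc (value (suc k) true (insert x S))      ≤⟨ s≤s (dominator-≤ {x = y} (legal⁺ {insert x S} {y} legal-y)) ⟩
      2 + value k false S₂                       ≤⟨ +-monoʳ-≤ 2 (staller-upper k S₂) ⟩
      2 + potential S₂                           ≤⟨ +-monoʳ-≤ 2 (Φ-mono (cell? S ∖ (j + toℕ x) ∖ a′) (cell? S₂) blocks paired) ⟩
      2 + Φ blocks (cell? S ∖ (j + toℕ x) ∖ a′)  ≡⟨ +-comm 2 _ ⟩
      Φ blocks (cell? S ∖ (j + toℕ x) ∖ a′) + 2  ≤⟨ drop ⟩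
      potential S                                ∎
      where
      open ≤-Reasoning
      S₂ : VSet
      S₂ = insert y (insert x S)

  shift-run : ∀ {a L c} → K ≤ c → InRange a (a + L) (c ∸ K) → InRange (K + a) (K + a + L) c
  shift-run {a} {L} {c} K≤c (a≤e , e<a+L) =
    subst (K + a ≤_) (cell-edge K≤c) (+-monoʳ-≤ K a≤e) ,
    subst₂ _<_ (cell-edge K≤c) (sym (+-assoc K a L)) (+-monoʳ-< K e<a+L)

  run-from-start : ∀ {Q : ℕ → Set} (Q? : Decidable Q) a L {s} → (∀ {c} → Q c → K ≤ c × InRange a (a + L) (c ∸ K)) →
                   K + a ≡ 5 * s → Φ blocks Q? ≤ movesS L
  run-from-start Q? a L {s} inside aligned = Φ-from-block-start blocks Q? L s λ {c} q →
    let K≤c , in-run = inside q in subst (λ b → InRange b (b + L) c) aligned (shift-run K≤c in-run)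

  run-to-end : ∀ {Q : ℕ → Set} (Q? : Decidable Q) a L {s} → (∀ {c} → Q c → K ≤ c × InRange a (a + L) (c ∸ K)) →
               K + a + L ≡ 5 * s → Φ blocks Q? ≤ movesS L
  run-to-end Q? a L {s} inside aligned = Φ-to-block-end blocks Q? L (K + a) s (λ {c} q →
    let K≤c , in-run = inside q
        lo≤c , c<end = shift-run K≤c in-run
    in lo≤c , subst (c <_) aligned c<end) aligned

  run-bound : ∀ {S} a L {s} → (∀ {e} → Alive S e → InRange a (a + L) e) → K + a ≡ 5 * s → potential S ≤ movesS L
  run-bound {S} a L {s} inside = run-from-start (cell? S) a L {s} λ (K≤c , alive) → K≤c , inside alive

  runs-bound : ∀ {S} a₁ L₁ a₂ L₂ {s₁ s₂} →
               (∀ {e} → Alive S e → InRange a₁ (a₁ + L₁) e ⊎ InRange a₂ (a₂ + L₂) e) →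
               K + a₁ ≡ 5 * s₁ → (K + a₂ ≡ 5 * s₂ ⊎ K + a₂ + L₂ ≡ 5 * s₂) →
               potential S ≤ movesS L₁ + movesS L₂
  runs-bound {S} a₁ L₁ a₂ L₂ {s₁} {s₂} inside aligned₁ aligned₂ =
    ≤-trans (Φ-subadditive blocks (cell? S) (run? a₁ L₁) (run? a₂ L₂) split)
            (+-mono-≤ (run-from-start (run? a₁ L₁) a₁ L₁ {s₁} id aligned₁) (second aligned₂))
    where
    run? : ∀ a L → Decidable (λ c → K ≤ c × InRange a (a + L) (c ∸ K))
    run? a L c = K ≤? c ×-dec inRange? a (a + L) (c ∸ K)
    split : ∀ {c} → Cell S c →
            (K ≤ c × InRange a₁ (a₁ + L₁) (c ∸ K)) ⊎ (K ≤ c × InRange a₂ (a₂ + L₂) (c ∸ K))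
    split (K≤c , alive) with inside alive
    ... | inj₁ in₁ = inj₁ (K≤c , in₁)
    ... | inj₂ in₂ = inj₂ (K≤c , in₂)
    second : (K + a₂ ≡ 5 * s₂ ⊎ K + a₂ + L₂ ≡ 5 * s₂) → Φ blocks (run? a₂ L₂) ≤ movesS L₂
    second (inj₁ start) = run-from-start (run? a₂ L₂) a₂ L₂ {s₂} id start
    second (inj₂ end)   = run-to-end (run? a₂ L₂) a₂ L₂ {s₂} id end

-- Opening moves

-- N stays a variable: for N = 6 + m literally, the conversion checker unfolds legal and value
-- over the first vertices and typechecking explodes.
module Openings (N m : ℕ) (N≡6+m : N ≡ 6 + m) where
  open PathGame N public
  open GameValue (P N) public
  open Chips N
  open LiveEdges N
  open StallerStrategy N

  ιg≡ : ιg (P N) ≡ value (6 + m) true ∅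
  ιg≡ = cong (λ k → value k true ∅) N≡6+m

  ιg'≡ : ιg' (P N) ≡ value (6 + m) false ∅
  ιg'≡ = cong (λ k → value k false ∅) N≡6+m

  bound⁻ : ∀ {e} → 2 + e ≤ N → e < 5 + m
  bound⁻ {e} b = s≤s⁻¹ (subst (2 + e ≤_) N≡6+m b)

  bound⁺ : ∀ {e} → e < 5 + m → 2 + e ≤ N
  bound⁺ {e} e< = subst (2 + e ≤_) (sym N≡6+m) (s≤s e<)

  2≤N : 2 ≤ N
  2≤N = bound⁺ {0} (s≤s z≤n)

  N≥5+m : 5 + m ≤ N
  N≥5+m = subst (5 + m ≤_) (sym N≡6+m) (n≤1+n _)

  low<N : ∀ k → k ≤ 5 → k < N
  low<N k k≤5 = subst (k <_) (sym N≡6+m) (s≤s (≤-trans k≤5 (m≤m+n 5 m)))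

  low-vertex : ∀ k → k ≤ 5 → V
  low-vertex k k≤5 = vertex k (low<N k k≤5)

  low-meets⁺ : ∀ {k e} (k≤5 : k ≤ 5) → Meets k e → Meets (toℕ (low-vertex k k≤5)) e
  low-meets⁺ k≤5 = meets-vertex (low<N _ k≤5)

  low-¬meets⁻ : ∀ {k e} (k≤5 : k ≤ 5) → ¬ Meets (toℕ (low-vertex k k≤5)) e → ¬ Meets k e
  low-¬meets⁻ {e = e} k≤5 = subst (λ u → ¬ Meets u e) (toℕ-fromℕ< (low<N _ k≤5))

  low-¬meets⁺ : ∀ {k e} (k≤5 : k ≤ 5) → ¬ Meets k e → ¬ Meets (toℕ (low-vertex k k≤5)) e
  low-¬meets⁺ {e = e} k≤5 = subst (λ u → ¬ Meets u e) (sym (toℕ-fromℕ< (low<N _ k≤5)))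

  alive-∅ : ∀ {e} → e < 5 + m → Alive ∅ e
  alive-∅ e< = bound⁺ e< , λ _ ()

  alive-one⁺ : ∀ {x e} → e < 5 + m → ¬ Meets (toℕ x) e → Alive (insert x ∅) e
  alive-one⁺ {x} e< ¬meets = alive-insert⁺ {x} {∅} (alive-∅ e<) ¬meets

  alive-one⁻ : ∀ {x e} → Alive (insert x ∅) e → e < 5 + m × ¬ Meets (toℕ x) e
  alive-one⁻ {x} alive = bound⁻ (proj₁ (proj₁ (alive-insert⁻ {x} {∅} alive))) , proj₂ (alive-insert⁻ {x} {∅} alive)

  opening-at : ∀ {S} k (k≤5 : k ≤ 5) e → Alive S e → Meets k e → T (legal S (low-vertex k k≤5))
  opening-at {S} k k≤5 e alive meets = legal⁺ {S} {low-vertex k k≤5} (e , alive , low-meets⁺ k≤5 meets)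

  dominator-start-lower : movesD (5 + m) ≤ ιg (P N)
  dominator-start-lower = subst (λ l → movesD l ≤ ιg (P N)) live-∅ (dominator-lower N ∅ (subst (_≤ N) (sym live-∅) N≥5+m))
    where
    live-∅ : live ∅ ≡ 5 + m
    live-∅ = count-exact (alive? ∅) (λ (bound , _) → z≤n , bound⁻ bound) (λ (_ , e<) → alive-∅ e<) N≥5+m

  staller-start-upper : ιg' (P N) ≤ movesS (5 + m)
  staller-start-upper = ≤-trans (staller-upper N ∅) (run-bound 0 (5 + m) {1} (λ (bound , _) → z≤n , bound⁻ bound) refl)
    where open DominatorStrategy N 3 2≤N

  dominator-start-upper : ιg (P N) ≤ suc (movesS (1 + m))
  dominator-start-upper = subst (_≤ suc (movesS (1 + m))) (sym ιg≡)
    (≤-trans (dominator-≤ {k = 5 + m} {S = ∅} {x = x} (opening-at 2 2≤5 0 (alive-∅ (s≤s z≤n)) (≤-refl , z≤n)))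
             (s≤s (≤-trans (staller-upper (5 + m) (insert x ∅)) (run-bound 4 (1 + m) {2} beyond-x refl))))
    where
    open DominatorStrategy N 4 2≤N
    2≤5 : 2 ≤ 5
    2≤5 = s≤s (s≤s z≤n)
    x : V
    x = low-vertex 2 2≤5
    beyond-x : ∀ {e} → Alive (insert x ∅) e → InRange 4 (4 + (1 + m)) e
    beyond-x alive with alive-one⁻ {x} alive
    ... | e< , ¬meets with ¬Meets⇒apart (low-¬meets⁻ 2≤5 ¬meets)
    ...   | inj₁ (s≤s (s≤s ()))
    ...   | inj₂ 4≤e = 4≤e , e<

  staller-start-lower : suc (movesD (3 + m)) ≤ ιg' (P N)
  staller-start-lower = subst (suc (movesD (3 + m)) ≤_) (sym ιg'≡)
    (≤-trans (s≤s (subst (λ l → movesD l ≤ value (5 + m) true S₁) live-S₁ (dominator-lower (5 + m) S₁ fuel)))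
             (staller-≥ {k = 5 + m} {S = ∅} {x = x} (opening-at 0 z≤n 0 (alive-∅ (s≤s z≤n)) (z≤n , z≤n))))
    where
    x : V
    x = low-vertex 0 z≤n
    S₁ : VSet
    S₁ = insert x ∅
    live-S₁ : live S₁ ≡ 3 + m
    live-S₁ = count-exact (alive? S₁) {2} {5 + m} alive⇒range range⇒alive N≥5+m
      where
      alive⇒range : ∀ {e} → Alive S₁ e → InRange 2 (5 + m) e
      alive⇒range alive with alive-one⁻ {x} alive
      ... | e< , ¬meets with ¬Meets⇒apart (low-¬meets⁻ z≤n ¬meets)
      ...   | inj₁ ()
      ...   | inj₂ 2≤e = 2≤e , e<
      range⇒alive : ∀ {e} → InRange 2 (5 + m) e → Alive S₁ e
      range⇒alive (2≤e , e<) =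
        alive-one⁺ {x} e< (low-¬meets⁺ z≤n λ (_ , e≤1) → contradiction (≤-trans 2≤e e≤1) (<-irrefl refl))
    fuel : live S₁ ≤ 5 + m
    fuel = subst (_≤ 5 + m) (sym live-S₁) (≤-trans (n≤1+n _) (n≤1+n _))

  staller-isolating-start-lower : 2 + movesD m ≤ ιg' (P N)
  staller-isolating-start-lower = subst (2 + movesD m ≤_) (sym ιg'≡)
    (≤-trans (s≤s (subst (λ l → suc (movesD (l ∸ 1)) ≤ value (5 + m) true S₁) live-S₁
                         (dominator-lower-isolated (5 + m) S₁ fuel alive-0 dead-1)))
             (staller-≥ {k = 5 + m} {S = ∅} {x = x}
                        (opening-at 3 3≤5 1 (alive-∅ (s≤s (s≤s z≤n))) (≤-refl , s≤s z≤n))))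
    where
    3≤5 : 3 ≤ 5
    3≤5 = s≤s (s≤s (s≤s z≤n))
    x : V
    x = low-vertex 3 3≤5
    S₁ : VSet
    S₁ = insert x ∅
    alive-0 : Alive S₁ 0
    alive-0 = alive-one⁺ {x} (s≤s z≤n) (low-¬meets⁺ 3≤5 λ { (s≤s (s≤s ()) , _) })
    dead-1 : ¬ Alive S₁ 1
    dead-1 alive = proj₂ (alive-one⁻ {x} alive) (low-meets⁺ 3≤5 (≤-refl , s≤s z≤n))
    far⇒alive : ∀ {e} → InRange 5 (5 + m) e → Alive S₁ e
    far⇒alive (5≤e , e<) =
      alive-one⁺ {x} e< (low-¬meets⁺ 3≤5 λ (_ , e≤4) → contradiction (≤-trans 5≤e e≤4) (<-irrefl refl))
    alive⇒far : ∀ {e} → Alive S₁ e → InRange 5 (5 + m) e ⊎ e ≡ 0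
    alive⇒far alive with alive-one⁻ {x} alive
    ... | e< , ¬meets with ¬Meets⇒apart (low-¬meets⁻ 3≤5 ¬meets)
    ...   | inj₁ (s≤s (s≤s (s≤s z≤n))) = inj₂ refl
    ...   | inj₂ 5≤e = inj₁ (5≤e , e<)
    live-S₁ : live S₁ ≡ suc m
    live-S₁ = trans (count-remove-one (alive? S₁) (inRange? 5 (5 + m)) {0} {N}
                                      far⇒alive alive⇒far alive-0 (λ { (() , _) }) (low<N 0 z≤n))
                    (cong suc (count-exact (inRange? 5 (5 + m)) {5} {5 + m} {N} (λ r → r) (λ r → r) N≥5+m))
    fuel : live S₁ ≤ 5 + m
    fuel = subst (_≤ 5 + m) (sym live-S₁) (m≤n+m _ 4)


module ThreeModFive (N p : ℕ) (N≡8+5p : N ≡ 8 + 5 * p) where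
  open Openings N (2 + 5 * p) N≡8+5p hiding (staller-start-upper)
  open Chips N using (vertex)

  respond : ∀ {x y} j {R} → Legal (insert x ∅) y → DominatorStrategy.potential N j 2≤N (insert y (insert x ∅)) ≤ R →
            value (7 + 5 * p) true (insert x ∅) ≤ suc R
  respond {x} {y} j legal-y bound =
    ≤-trans (dominator-≤ {k = 6 + 5 * p} {S = insert x ∅} {x = y} (legal⁺ {insert x ∅} {y} legal-y))
            (s≤s (≤-trans (staller-upper (6 + 5 * p) (insert y (insert x ∅))) bound))
    where open DominatorStrategy N j 2≤N

  alive-two⁻ : ∀ {x y e} → Alive (insert y (insert x ∅)) e → e < 7 + 5 * p × ¬ Meets (toℕ x) e × ¬ Meets (toℕ y) e
  alive-two⁻ {x} {y} alive with alive-insert⁻ {y} {insert x ∅} alive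
  ... | alive-x , ¬meets-y = proj₁ (alive-one⁻ {x} alive-x) , proj₂ (alive-one⁻ {x} alive-x) , ¬meets-y

  -- Staller's vertex 2 + d splits the live edges into runs below d and from 4 + d; Dominator trims an end
  -- of the path so that, for the shift j, each run starts (or the second one ends) at a block boundary.
  split-reply : ∀ {x y} j {X Y} d {lo hi L₁ L₂ s₁ s₂} → toℕ x ≡ X → toℕ y ≡ Y → X ≡ 2 + d →
                Legal (insert x ∅) y →
                (∀ {e} → e < 7 + 5 * p → ¬ Meets Y e → InRange lo hi e) →
                d ≤ lo + L₁ → hi ≤ 4 + d + L₂ →
                2 + j + lo ≡ 5 * s₁ → (2 + j + (4 + d) ≡ 5 * s₂ ⊎ 2 + j + (4 + d) + L₂ ≡ 5 * s₂) →
                movesS L₁ + movesS L₂ ≤ 1 + 2 * p → value (7 + 5 * p) true (insert x ∅) ≤ 2 + 2 * p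
  split-reply {x} {y} j d {lo} {hi} {L₁} {L₂} {s₁} {s₂} refl refl X≡2+d legal-y trimmed d≤ hi≤ aligned₁ aligned₂ total =
    respond {x} {y} j legal-y
      (≤-trans (runs-bound {insert y (insert x ∅)} lo L₁ (4 + d) L₂ {s₁} {s₂} runs aligned₁ aligned₂) total)
    where
    open DominatorStrategy N j 2≤N
    runs : ∀ {e} → Alive (insert y (insert x ∅)) e → InRange lo (lo + L₁) e ⊎ InRange (4 + d) (4 + d + L₂) e
    runs {e} alive with alive-two⁻ {x} {y} alive
    ... | e< , ¬meets-x , ¬meets-y with trimmed e< ¬meets-y | ¬Meets⇒apart (subst (λ u → ¬ Meets u e) X≡2+d ¬meets-x)
    ...   | lo≤e , e<hi | inj₁ e+3≤x = inj₁ (lo≤e , ≤-trans (s≤s⁻¹ (s≤s⁻¹ e+3≤x)) d≤)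
    ...   | lo≤e , e<hi | inj₂ x+2≤e = inj₂ (x+2≤e , ≤-trans e<hi hi≤)

  last : V
  last = vertex (7 + 5 * p) (subst (7 + 5 * p <_) (sym N≡8+5p) ≤-refl)

  toℕ-last : toℕ last ≡ 7 + 5 * p
  toℕ-last = toℕ-fromℕ< _

  trim-left : ∀ {Y e} → Y ≤ 2 → e < 7 + 5 * p → ¬ Meets Y e → InRange (2 + Y) (7 + 5 * p) e
  trim-left Y≤2 e< ¬meets with ¬Meets⇒apart ¬meets
  ... | inj₁ 3+e≤Y = contradiction (≤-trans 3+e≤Y Y≤2) λ { (s≤s (s≤s ())) }
  ... | inj₂ Y+2≤e = Y+2≤e , e<

  trim-right : ∀ {e} → e < 7 + 5 * p → ¬ Meets (7 + 5 * p) e → InRange 0 (5 + 5 * p) e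
  trim-right e< ¬meets with ¬Meets⇒apart ¬meets
  ... | inj₁ 3+e≤last = z≤n , s≤s⁻¹ (s≤s⁻¹ 3+e≤last)
  ... | inj₂ last+2≤e = contradiction (≤-trans e< (≤-trans (n≤1+n _) (n≤1+n _))) (≤⇒≯ last+2≤e)

  legal-left : ∀ {x} Y (Y≤5 : Y ≤ 5) → Y ≤ 2 → 3 ≤ toℕ x → Legal (insert x ∅) (low-vertex Y Y≤5)
  legal-left Y Y≤5 Y≤2 3≤x = 0 , alive-one⁺ (s≤s z≤n) (λ (x≤2 , _) → <-irrefl refl (≤-trans 3≤x x≤2)) ,
                            low-meets⁺ Y≤5 (Y≤2 , z≤n)

  legal-right : ∀ {x} → toℕ x ≤ 4 + 5 * p → Legal (insert x ∅) last
  legal-right x≤ = 6 + 5 * p , alive-one⁺ ≤-refl (λ (_ , e≤) → <-irrefl refl (≤-trans e≤ (s≤s x≤))) ,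
                  subst (λ u → Meets u (6 + 5 * p)) (sym toℕ-last) (n≤1+n _ , ≤-trans (n≤1+n _) (n≤1+n _))

  runs-total : ∀ r₁ r₂ α k → movesS r₁ + movesS r₂ ≡ 1 → p ≡ α + k →
               movesS (r₁ + 5 * α) + movesS (r₂ + 5 * k) ≤ 1 + 2 * p
  runs-total r₁ r₂ α k one p≡α+k = ≤-reflexive (begin
    movesS (r₁ + 5 * α) + movesS (r₂ + 5 * k)   ≡⟨ cong₂ _+_ (movesS-+5* r₁ α) (movesS-+5* r₂ k) ⟩
    movesS r₁ + 2 * α + (movesS r₂ + 2 * k)     ≡⟨ interchange (movesS r₁) (2 * α) (movesS r₂) (2 * k) ⟩
    movesS r₁ + movesS r₂ + (2 * α + 2 * k)     ≡⟨ cong₂ _+_ one (sym (*-distribˡ-+ 2 α k)) ⟩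
    1 + 2 * (α + k)                             ≡⟨ cong (λ q → 1 + 2 * q) (sym p≡α+k) ⟩
    1 + 2 * p                                   ∎)
    where open ≡-Reasoning

  reply-near-start : ∀ x → toℕ x ≤ 1 → value (7 + 5 * p) true (insert x ∅) ≤ 2 + 2 * p
  reply-near-start x x≤1 =
    respond {x} {y} 2 legal-y (≤-trans (run-bound 6 (1 + 5 * p) {2} runs refl) (≤-reflexive (movesS-+5* 1 p)))
    where
    open DominatorStrategy N 2 2≤N
    4≤5 : 4 ≤ 5
    4≤5 = s≤s (s≤s (s≤s (s≤s z≤n)))
    y : V
    y = low-vertex 4 4≤5
    legal-y : Legal (insert x ∅) y
    legal-y = 5 , alive-one⁺ (m≤m+n 6 (1 + 5 * p))
                    (λ (_ , 5≤1+x) → contradiction (≤-trans 5≤1+x (s≤s x≤1)) λ { (s≤s (s≤s ())) }) ,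
              low-meets⁺ 4≤5 (m≤m+n 4 3 , ≤-refl)
    runs : ∀ {e} → Alive (insert y (insert x ∅)) e → InRange 6 (6 + (1 + 5 * p)) e
    runs alive with alive-two⁻ {x} {y} alive
    ... | e< , ¬meets-x , ¬meets-y with ¬Meets⇒apart (low-¬meets⁻ 4≤5 ¬meets-y)
    ...   | inj₁ 3+e≤4 =
      contradiction (≤-trans x≤1 (s≤s z≤n) , ≤-trans (s≤s⁻¹ (s≤s⁻¹ (s≤s⁻¹ 3+e≤4))) (m≤m+n 1 _)) ¬meets-x
    ...   | inj₂ 6≤e   = 6≤e , e<

  clear-of-last-edge : ∀ α k r → r ≤ 2 → p ≡ α + k → 2 + (5 * α + r) ≤ 4 + 5 * p
  clear-of-last-edge α k r r≤2 p≡ = ≤-trans (+-monoʳ-≤ 2 (+-mono-≤ (*-monoʳ-≤ 5 (m≤m+n α k)) r≤2))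
                                     (≤-reflexive (trans (eq α k) (cong (λ q → 4 + 5 * q) (sym p≡))))
    where
    eq : ∀ α k → 2 + (5 * (α + k) + 2) ≡ 4 + 5 * (α + k)
    eq = solve-∀

  past-start : ∀ {x : V} α {r} → toℕ x ≡ 2 + (5 * α + suc r) → 3 ≤ toℕ x
  past-start {x} α {r} x≡ = subst (3 ≤_) (sym x≡) (+-monoʳ-≤ 2 (≤-trans (s≤s z≤n) (m≤n+m _ (5 * α))))

  reply-split-0 : ∀ x α k → toℕ x ≡ 2 + (5 * α + 0) → p ≡ α + k → value (7 + 5 * p) true (insert x ∅) ≤ 2 + 2 * p
  reply-split-0 x α k x≡ p≡ =
    split-reply {x} {last} 3 (5 * α + 0) {0} {5 + 5 * p} {0 + 5 * α} {1 + 5 * k} {1} {2 + p} x≡ toℕ-last refl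
      (legal-right (subst (_≤ 4 + 5 * p) (sym x≡) (clear-of-last-edge α k 0 z≤n p≡))) trim-right
      (≤-reflexive (+-identityʳ _)) (≤-reflexive (trans (cong (λ q → 5 + 5 * q) p≡) (hi-eq α k))) refl
      (inj₂ (trans (end-eq α k) (cong (λ q → 5 * (2 + q)) (sym p≡)))) (runs-total 0 1 α k refl p≡)
    where
    hi-eq : ∀ α k → 5 + 5 * (α + k) ≡ 4 + (5 * α + 0) + (1 + 5 * k)
    hi-eq = solve-∀
    end-eq : ∀ α k → 2 + 3 + (4 + (5 * α + 0)) + (1 + 5 * k) ≡ 5 * (2 + (α + k))
    end-eq = solve-∀

  reply-split-1 : ∀ x α k → toℕ x ≡ 2 + (5 * α + 1) → p ≡ α + k → value (7 + 5 * p) true (insert x ∅) ≤ 2 + 2 * p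
  reply-split-1 x α k x≡ p≡ =
    split-reply {x} {last} 3 (5 * α + 1) {0} {5 + 5 * p} {1 + 5 * α} {0 + 5 * k} {1} {2 + α} x≡ toℕ-last refl
      (legal-right (subst (_≤ 4 + 5 * p) (sym x≡) (clear-of-last-edge α k 1 (s≤s z≤n) p≡))) trim-right
      (≤-reflexive (+-comm (5 * α) 1)) (≤-reflexive (trans (cong (λ q → 5 + 5 * q) p≡) (hi-eq α k))) refl
      (inj₁ (start-eq α)) (runs-total 1 0 α k refl p≡)
    where
    hi-eq : ∀ α k → 5 + 5 * (α + k) ≡ 4 + (5 * α + 1) + (0 + 5 * k)
    hi-eq = solve-∀
    start-eq : ∀ α → 2 + 3 + (4 + (5 * α + 1)) ≡ 5 * (2 + α)
    start-eq = solve-∀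

  reply-split-2 : ∀ x α k → toℕ x ≡ 2 + (5 * α + 2) → p ≡ α + k → value (7 + 5 * p) true (insert x ∅) ≤ 2 + 2 * p
  reply-split-2 x α k x≡ p≡ =
    split-reply {x} {low-vertex 0 z≤n} 6 (5 * α + 2) {2} {7 + 5 * p} {0 + 5 * α} {1 + 5 * k} {2} {3 + p} x≡ (toℕ-fromℕ< _) refl
      (legal-left 0 z≤n z≤n (past-start α x≡)) (trim-left z≤n)
      (≤-reflexive (+-comm (5 * α) 2)) (≤-reflexive (trans (cong (λ q → 7 + 5 * q) p≡) (hi-eq α k))) refl
      (inj₂ (trans (end-eq α k) (cong (λ q → 5 * (3 + q)) (sym p≡)))) (runs-total 0 1 α k refl p≡)
    where
    hi-eq : ∀ α k → 7 + 5 * (α + k) ≡ 4 + (5 * α + 2) + (1 + 5 * k)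
    hi-eq = solve-∀
    end-eq : ∀ α k → 2 + 6 + (4 + (5 * α + 2)) + (1 + 5 * k) ≡ 5 * (3 + (α + k))
    end-eq = solve-∀

  reply-split-3 : ∀ x α k → toℕ x ≡ 2 + (5 * α + 3) → p ≡ α + k → value (7 + 5 * p) true (insert x ∅) ≤ 2 + 2 * p
  reply-split-3 x α k x≡ p≡ =
    split-reply {x} {low-vertex 0 z≤n} 6 (5 * α + 3) {2} {7 + 5 * p} {1 + 5 * α} {0 + 5 * k} {2} {3 + α} x≡ (toℕ-fromℕ< _) refl
      (legal-left 0 z≤n z≤n (past-start α x≡)) (trim-left z≤n)
      (≤-reflexive (+-comm (5 * α) 3)) (≤-reflexive (trans (cong (λ q → 7 + 5 * q) p≡) (hi-eq α k))) refl
      (inj₁ (start-eq α)) (runs-total 1 0 α k refl p≡)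
    where
    hi-eq : ∀ α k → 7 + 5 * (α + k) ≡ 4 + (5 * α + 3) + (0 + 5 * k)
    hi-eq = solve-∀
    start-eq : ∀ α → 2 + 6 + (4 + (5 * α + 3)) ≡ 5 * (3 + α)
    start-eq = solve-∀

  reply-split-4 : ∀ x α k → toℕ x ≡ 2 + (5 * α + 4) → p ≡ α + k → value (7 + 5 * p) true (insert x ∅) ≤ 2 + 2 * p
  reply-split-4 x α k x≡ p≡ =
    split-reply {x} {low-vertex 1 (s≤s z≤n)} 5 (5 * α + 4) {3} {7 + 5 * p} {1 + 5 * α} {0 + 5 * k} {2} {3 + α}
      x≡ (toℕ-fromℕ< _) refl
      (legal-left 1 (s≤s z≤n) (s≤s z≤n) (past-start α x≡))
      (trim-left (s≤s z≤n))
      (≤-reflexive (+-comm (5 * α) 4)) (≤-trans (n≤1+n _) (≤-reflexive (trans (cong (λ q → 8 + 5 * q) p≡) (hi-eq α k)))) refl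
      (inj₁ (start-eq α)) (runs-total 1 0 α k refl p≡)
    where
    hi-eq : ∀ α k → 8 + 5 * (α + k) ≡ 4 + (5 * α + 4) + (0 + 5 * k)
    hi-eq = solve-∀
    start-eq : ∀ α → 2 + 5 + (4 + (5 * α + 4)) ≡ 5 * (3 + α)
    start-eq = solve-∀

  reply-at-end : ∀ x → toℕ x ≡ 2 + (5 * (1 + p) + 0) → value (7 + 5 * p) true (insert x ∅) ≤ 2 + 2 * p
  reply-at-end x x≡ =
    split-reply {x} {low-vertex 2 2≤5} 4 (5 * (1 + p) + 0) {4} {7 + 5 * p} {1 + 5 * p} {0 + 5 * 0} {2} {3 + p} x≡ (toℕ-fromℕ< _) refl
      (legal-left 2 2≤5 ≤-refl (subst (3 ≤_) (sym x≡) (s≤s (s≤s (s≤s z≤n)))))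
      (trim-left ≤-refl)
      (≤-reflexive (d-eq p)) (≤-trans (n≤1+n _) (≤-trans (n≤1+n _) (≤-reflexive (hi-eq p)))) refl
      (inj₁ (start-eq p)) (runs-total 1 0 p 0 refl (sym (+-identityʳ p)))
    where
    2≤5 : 2 ≤ 5
    2≤5 = s≤s (s≤s z≤n)
    d-eq : ∀ p → 5 * (1 + p) + 0 ≡ 4 + (1 + 5 * p)
    d-eq = solve-∀
    hi-eq : ∀ p → 9 + 5 * p ≡ 4 + (5 * (1 + p) + 0) + (0 + 5 * 0)
    hi-eq = solve-∀
    start-eq : ∀ p → 2 + 4 + (4 + (5 * (1 + p) + 0)) ≡ 5 * (3 + p)
    start-eq = solve-∀

  staller-reply : ∀ x → value (7 + 5 * p) true (insert x ∅) ≤ 2 + 2 * p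
  staller-reply x with toℕ x ≤? 1
  ... | yes x≤1 = reply-near-start x x≤1
  ... | no x≰1 with block-decomposition (toℕ x ∸ 2)
  ...   | α , r , r<5 , d≡ = by-offset r r<5 (trans (sym (m+[n∸m]≡n (≰⇒> x≰1))) (cong (2 +_) d≡))
    where
    room : ∀ {r} → toℕ x ≡ 2 + (5 * α + r) → 5 * α + r ≤ 5 * (1 + p)
    room x≡ = ≤-trans (s≤s⁻¹ (s≤s⁻¹ (s≤s⁻¹ (subst (λ u → suc u ≤ 8 + 5 * p) x≡
                                                  (subst (suc (toℕ x) ≤_) N≡8+5p (toℕ<n x))))))
                      (≤-reflexive (sym (*-suc 5 p)))
    α≤p : ∀ {r} → 1 ≤ r → toℕ x ≡ 2 + (5 * α + r) → α ≤ p
    α≤p {r} 1≤r x≡ = s≤s⁻¹ (*-cancelˡ-< 5 α (1 + p)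
      (≤-trans (subst (_≤ 5 * α + r) (+-comm (5 * α) 1) (+-monoʳ-≤ (5 * α) 1≤r)) (room x≡)))
    p≡α+k : α ≤ p → p ≡ α + (p ∸ α)
    p≡α+k α≤p = sym (m+[n∸m]≡n α≤p)
    by-offset : ∀ r → r < 5 → toℕ x ≡ 2 + (5 * α + r) → value (7 + 5 * p) true (insert x ∅) ≤ 2 + 2 * p
    by-offset 0 _ x≡ with m≤n⇒m<n∨m≡n (*-cancelˡ-≤ 5 (subst (_≤ 5 * (1 + p)) (+-identityʳ (5 * α)) (room x≡)))
    ... | inj₁ α<1+p = reply-split-0 x α (p ∸ α) x≡ (p≡α+k (s≤s⁻¹ α<1+p))
    ... | inj₂ refl  = reply-at-end x x≡
    by-offset 1 _ x≡ = reply-split-1 x α (p ∸ α) x≡ (p≡α+k (α≤p (s≤s z≤n) x≡))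
    by-offset 2 _ x≡ = reply-split-2 x α (p ∸ α) x≡ (p≡α+k (α≤p (s≤s z≤n) x≡))
    by-offset 3 _ x≡ = reply-split-3 x α (p ∸ α) x≡ (p≡α+k (α≤p (s≤s z≤n) x≡))
    by-offset 4 _ x≡ = reply-split-4 x α (p ∸ α) x≡ (p≡α+k (α≤p (s≤s z≤n) x≡))
    by-offset (suc (suc (suc (suc (suc _))))) r<5 _ = contradiction r<5 λ { (s≤s (s≤s (s≤s (s≤s (s≤s ()))))) }

  staller-start-upper : ιg' (P N) ≤ 3 + 2 * p
  staller-start-upper = subst (_≤ 3 + 2 * p) (sym ιg'≡)
    (staller-≤ {k = 7 + 5 * p} {S = ∅} (3 + 2 * p) λ x _ → s≤s (staller-reply x))

squeeze : ∀ {a x b c} → a ≤ x → x ≤ b → a ≡ c → b ≡ c → x ≡ c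
squeeze {a} a≤x x≤b refl b≡a = ≤-antisym (≤-trans x≤b (≤-reflexive b≡a)) a≤x

residue-form : ∀ n r → 6 ≤ n → n % 5 ≡ r → r ≤ 4 → ∃ λ p → n ≡ (5 + r) + 5 * p
residue-form n r 6≤n n%5≡r r≤4 with n / 5 | m≡m%n+[m/n]*n n 5
... | zero  | n≡ =
  contradiction (≤-trans 6≤n (≤-trans (≤-reflexive (trans n≡ (trans (cong (_+ 0) n%5≡r) (+-identityʳ r)))) r≤4))
                λ { (s≤s (s≤s (s≤s (s≤s ())))) }
... | suc p | n≡ = p , trans n≡ (trans (cong (_+ suc p * 5) n%5≡r) (eq r p))
  where
  eq : ∀ r p → r + suc p * 5 ≡ 5 + r + 5 * p
  eq = solve-∀

two-fifths : ∀ {n} c p → n ≡ c + 5 * p → (2 * n + 2) / 5 ≡ (2 * c + 2) / 5 + 2 * p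
two-fifths c p refl = begin
  (2 * (c + 5 * p) + 2) / 5           ≡⟨ cong (_/ 5) (eq c p) ⟩
  (2 * c + 2 + 2 * p * 5) / 5         ≡⟨ +-distrib-/-∣ʳ (2 * c + 2) (divides-refl (2 * p)) ⟩
  (2 * c + 2) / 5 + 2 * p * 5 / 5     ≡⟨ cong ((2 * c + 2) / 5 +_) (m*n/n≡m (2 * p) 5) ⟩
  (2 * c + 2) / 5 + 2 * p             ∎
  where
  open ≡-Reasoning
  eq : ∀ c p → 2 * (c + 5 * p) + 2 ≡ (2 * c + 2) + 2 * p * 5
  eq = solve-∀

values-6+5p : ∀ n p → n ≡ 6 + 5 * p → ιg (P n) ≡ 2 + 2 * p × ιg' (P n) ≡ 2 + 2 * p
values-6+5p n p n≡ =
  squeeze dominator-start-lower dominator-start-upper (cong (2 +_) (movesD-+5* 0 p)) (cong suc (movesS-+5* 1 p)) ,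
  squeeze staller-start-lower staller-start-upper (cong suc (movesD-+5* 3 p)) (cong (2 +_) (movesS-+5* 0 p))
  where open Openings n (5 * p) n≡

values-7+5p : ∀ n p → n ≡ 7 + 5 * p → ιg (P n) ≡ 3 + 2 * p × ιg' (P n) ≡ 3 + 2 * p
values-7+5p n p n≡ =
  squeeze dominator-start-lower dominator-start-upper (cong (2 +_) (movesD-+5* 1 p)) (cong suc (movesS-+5* 2 p)) ,
  squeeze staller-isolating-start-lower staller-start-upper (cong (2 +_) (movesD-+5* 1 p)) (cong (2 +_) (movesS-+5* 1 p))
  where open Openings n (1 + 5 * p) n≡

values-8+5p : ∀ n p → n ≡ 8 + 5 * p → ιg (P n) ≡ 3 + 2 * p × ιg' (P n) ≡ 3 + 2 * p
values-8+5p n p n≡ =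
  squeeze dominator-start-lower dominator-start-upper (cong (2 +_) (movesD-+5* 2 p)) (cong suc (movesS-+5* 3 p)) ,
  squeeze staller-start-lower (ThreeModFive.staller-start-upper n p n≡) (cong (3 +_) (movesD-+5* 0 p)) refl
  where open Openings n (2 + 5 * p) n≡

agree : ∀ {a b v t : ℕ} → a ≡ v × b ≡ v → t ≡ v → a ≡ t × b ≡ t
agree (a≡v , b≡v) t≡v = trans a≡v (sym t≡v) , trans b≡v (sym t≡v)

corollary4p6 : (n : ℕ) → 6 ≤ n → (n % 5 ≡ 1 ⊎ n % 5 ≡ 2 ⊎ n % 5 ≡ 3) →
    (ιg (P n) ≡ (2 * n + 2) / 5) × (ιg' (P n) ≡ (2 * n + 2) / 5)
corollary4p6 n 6≤n (inj₁ n%5≡1) with residue-form n 1 6≤n n%5≡1 (s≤s z≤n)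
... | p , n≡ = agree (values-6+5p n p n≡) (two-fifths 6 p n≡)
corollary4p6 n 6≤n (inj₂ (inj₁ n%5≡2)) with residue-form n 2 6≤n n%5≡2 (s≤s (s≤s z≤n))
... | p , n≡ = agree (values-7+5p n p n≡) (two-fifths 7 p n≡)
corollary4p6 n 6≤n (inj₂ (inj₂ n%5≡3)) with residue-form n 3 6≤n n%5≡3 (s≤s (s≤s (s≤s z≤n)))
... | p , n≡ = agree (values-8+5p n p n≡) (two-fifths 8 p n≡)
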